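{- Let $\lambda$ be a partition, $\pi$ a reverse plane partition of shape $\lambda$, $h$ a rim-hook of $\lambda$ and $u\in\mathrm{cand}(\pi)$. If $u\triangleleft\alpha(P(h,\pi))$, then $h(u,\pi)<h$.
   Context: Cells are pairs $(i,j)\in\mathbb Z^2$; $\mathrm n(i,j)=(i-1,j)$, $\mathrm e(i,j)=(i,j+1)$, $\mathrm s(i,j)=(i+1,j)$, $\mathrm w(i,j)=(i,j-1)$. A partition $\lambda$ is identified with its Young diagram; $\lambda'$ is its conjugate. A reverse plane partition of shape $\lambda$ is $\pi:\lambda\to\mathbb N$ with $\pi(u)\le\pi(\mathrm e u),\pi(\mathrm s u)$, with conventions $\pi(i,j)=0$ if $i\le0$ or $j\le0$, $\pi(i,j)=\infty$ if $i,j\ge1$, $(i,j)\notin\lambda$. Content $c(i,j)=j-i$; outer corner: $u\in\lambda$, $\mathrm e u,\mathrm s u\notin\lambda$; inner corner: $\mathrm e u,\mathrm s u\in\lambda$, $\mathrm e\mathrm s u\notin\lambda$. With inner corner contents $i_1<\dots<i_r$ and outer corner contents $o_1<\dots<o_{r+1}$ (interlacing), $\mathcal I=\{u\in\lambda:c(u)=i_k\}$, $\mathcal O=\{u\in\lambda:c(u)=o_k\}$, $\mathcal A=\{u\in\lambda:c(u)<o_1\text{ or }i_k<c(u)<o_{k+1}\text{ for some }k\in[r]\}$, $\mathcal B=\{u\in\lambda:o_k<c(u)<i_k\text{ for some }k\in[r]\text{ or }c(u)>o_{r+1}\}$. Content order: $(i,j)\trianglelefteq(k,l)$ iff $j-i>l-k$,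 or $j-i=l-k$ and $i\ge k$; $\triangleleft$ strict. Candidates: $\mathrm{cand}(\pi)=\{u\in\mathcal O:\pi(u)>\pi(\mathrm w u)\}\cup\{u\in\mathcal A:\pi(u)>\pi(\mathrm w u),\pi(u)>\pi(\mathrm n u)\}$. North-east path: $(u_0,\dots,u_s)$ in $\lambda$, $u_k\in\{\mathrm n u_{k-1},\mathrm e u_{k-1}\}$, length $s$, head $\alpha=u_0$, tail $\omega=u_s$. South-west path: $(v_0,\dots,v_s)$, $v_k\in\{\mathrm s v_{k-1},\mathrm w v_{k-1}\}$, length $s$, $\alpha=v_s$, $\omega=v_0$. Rim-hook: north-east path $h$ with $\mathrm s\alpha(h)\notin\lambda$, $\mathrm e\omega(h)\notin\lambda$, $\mathrm e\mathrm s u\notin\lambda$ for all $u\in h$; for $u=(i,j)\in\lambda$, $h^u$ is the rim-hook from $(\lambda'_j,j)$ to $(i,\lambda_i)$, and these are all rim-hooks. Reverse lexicographic order on cells: $(i,j)\le(k,l)$ iff $j>l$, or $j=l$ and $i\ge k$; rim-hooks ordered by $h^u\le h^v$ iff $u\le v$ ($<$ strict). $P(h,\pi)$: the south-west path starting at $\omega(h)$ which, while its length is less than $\ell(h)$, moves from current cell $w$ to $\mathrm s w$ if $w\in\mathcal B\cup\mathcal I$ and $\pi(w)=\pi(\mathrm s w)$, and to $\mathrm w w$ otherwise. For $v\in\mathrm{cand}(\pi)$, $Q(v,\pi)$ is the north-east path starting at $v$ which, from current cell $w$, moves to $\mathrm n w$ if $w\in\mathcal O\cup\mathcal B$ and $\pi(w)=\pi(\mathrm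 n w)$; to $\mathrm e w$ if $w\in\mathcal I\cup\mathcal A$, or if $\mathrm e w\in\lambda$ and $\pi(w)>\pi(\mathrm n w)$; and terminates if $\pi(w)>\pi(\mathrm n w)$ and $\mathrm e w\notin\lambda$. $h(v,\pi)$ is the rim-hook with $\omega(h(v,\pi))=\omega(Q(v,\pi))$ and $\ell(h(v,\pi))=\ell(Q(v,\pi))$. -}

module Defs where

open import Data.Bool using (Bool; true; false; _∧_; _∨_; not; if_then_else_; T)
open import Data.Nat as ℕ using (ℕ; zero; suc)
open import Data.Integer as ℤ using (ℤ; +_; -[1+_]; _-_; _+_; _≤ᵇ_)
import Data.Integer.Properties as ℤP
open import Data.Product using (_×_; _,_; proj₁; proj₂; Σ; ∃)
open import Data.Sum using (_⊎_)
open import Data.List using (List; []; _∷_; _++_; length; map; upTo; filterᵇ; zip; drop)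
open import Data.Bool.ListAction using (any)
open import Data.List.NonEmpty as L⁺ using (List⁺; _∷_; head; last; tail; toList)
open import Data.List.Relation.Unary.All using (All)
open import Data.List.Relation.Unary.Linked using (Linked)
open import Relation.Binary.PropositionalEquality using (_≡_; _≢_)
open import Relation.Nullary using (¬_)
open import Data.List.Sort ℤP.≤-decTotalOrder using (sort)

record Partition : Set where
  field
    parts      : List ℕ
    positive   : All (λ k → 0 ℕ.< k) parts
    decreasing : Linked ℕ._≥_ parts

Cell : Set
Cell = ℤ × ℤ

row col : Cell → ℤ
row = proj₁
col = proj₂

nC eC sC wC : Cell → Cell
nC (i , j) = (i - + 1 , j)
eC (i , j) = (i , j + + 1)
sC (i , j) = (i + + 1 , j)
wC (i , j) = (i , j - + 1)

content : Cell → ℤ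
content (i , j) = j - i

nth : List ℕ → ℕ → ℕ
nth []       _       = 0
nth (m ∷ ms) zero    = m
nth (m ∷ ms) (suc k) = nth ms k

-- λ_i for i ∈ ℤ (0 if i ≤ 0 or i > ℓ(λ))
rowLen : List ℕ → ℤ → ℕ
rowLen ps (+ zero)  = 0
rowLen ps (+ suc k) = nth ps k
rowLen ps -[1+ _ ]  = 0

_<ᶻ_ : ℤ → ℤ → Bool
a <ᶻ b = (a + + 1) ≤ᵇ b

_==ᶻ_ : ℤ → ℤ → Bool
a ==ᶻ b = (a ≤ᵇ b) ∧ (b ≤ᵇ a)

inλ : List ℕ → Cell → Bool
inλ ps (i , j) = (+ 1 ≤ᵇ j) ∧ (j ≤ᵇ + rowLen ps i)

InΛ : List ℕ → Cell → Set
InΛ ps u = T (inλ ps u)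

data Val : Set where
  fin : ℕ → Val
  ∞   : Val

_≤ᵛ_ : Val → Val → Bool
fin a ≤ᵛ fin b = a ℕ.≤ᵇ b
fin a ≤ᵛ ∞     = true
∞     ≤ᵛ fin b = false
∞     ≤ᵛ ∞     = true

_<ᵛ_ : Val → Val → Bool
a <ᵛ b = not (b ≤ᵛ a)

_==ᵛ_ : Val → Val → Bool
a ==ᵛ b = (a ≤ᵛ b) ∧ (b ≤ᵛ a)

ext : List ℕ → (Cell → ℕ) → Cell → Val
ext ps π (i , j) =
  if (i ≤ᵇ + 0) ∨ (j ≤ᵇ + 0) then fin 0
  else (if inλ ps (i , j) then fin (π (i , j)) else ∞)

-- reverse plane partition of shape λ (only the values on λ matter)
IsRPP : List ℕ → (Cell → ℕ) → Set
IsRPP ps π = ∀ u → InΛ ps u →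
  T (ext ps π u ≤ᵛ ext ps π (eC u)) × T (ext ps π u ≤ᵛ ext ps π (sC u))

cellsFrom : ℕ → List ℕ → List Cell
cellsFrom k []       = []
cellsFrom k (m ∷ ms) = map (λ j → (+ suc k , + suc j)) (upTo m) ++ cellsFrom (suc k) ms

cells : List ℕ → List Cell
cells ps = cellsFrom 0 ps

isOuter : List ℕ → Cell → Bool
isOuter ps u = inλ ps u ∧ not (inλ ps (eC u)) ∧ not (inλ ps (sC u))

isInner : List ℕ → Cell → Bool
isInner ps u = inλ ps (eC u) ∧ inλ ps (sC u) ∧ not (inλ ps (eC (sC u)))

outerContents : List ℕ → List ℤ
outerContents ps = sort (map content (filterᵇ (isOuter ps) (cells ps)))

innerContents : List ℕ → List ℤ
innerContents ps = sort (map content (filterᵇ (isInner ps) (cells ps)))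

headOr : List ℤ → ℤ
headOr []      = + 0
headOr (x ∷ _) = x

lastOr : List ℤ → ℤ
lastOr []           = + 0
lastOr (x ∷ [])     = x
lastOr (_ ∷ y ∷ ys) = lastOr (y ∷ ys)

elemᶻ : ℤ → List ℤ → Bool
elemᶻ c xs = any (λ x → c ==ᶻ x) xs

inI : List ℕ → Cell → Bool
inI ps u = inλ ps u ∧ elemᶻ (content u) (innerContents ps)

inO : List ℕ → Cell → Bool
inO ps u = inλ ps u ∧ elemᶻ (content u) (outerContents ps)

inA : List ℕ → Cell → Bool
inA ps u = inλ ps u ∧
  ((c <ᶻ headOr os) ∨ any (λ p → (proj₁ p <ᶻ c) ∧ (c <ᶻ proj₂ p)) (zip is (drop 1 os)))
  where
  c  = content u
  os = outerContents ps
  is = innerContents ps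

inB : List ℕ → Cell → Bool
inB ps u = inλ ps u ∧
  (any (λ p → (proj₁ p <ᶻ c) ∧ (c <ᶻ proj₂ p)) (zip os is) ∨ (lastOr os <ᶻ c))
  where
  c  = content u
  os = outerContents ps
  is = innerContents ps

_⊴_ : Cell → Cell → Set
u ⊴ v = (content v ℤ.< content u) ⊎ ((content u ≡ content v) × (row v ℤ.≤ row u))

_◁_ : Cell → Cell → Set
u ◁ v = (u ⊴ v) × (u ≢ v)

_≤ʳ_ : Cell → Cell → Set
u ≤ʳ v = (col v ℤ.< col u) ⊎ ((col u ≡ col v) × (row v ℤ.≤ row u))

_<ʳ_ : Cell → Cell → Set
u <ʳ v = (u ≤ʳ v) × (u ≢ v)

NEStep : Cell → Cell → Set
NEStep u v = (v ≡ nC u) ⊎ (v ≡ eC u)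

α ω : List⁺ Cell → Cell
α = head
ω = last

len : List⁺ Cell → ℕ
len p = length (tail p)

IsNEPath : List ℕ → List⁺ Cell → Set
IsNEPath ps p = All (InΛ ps) (toList p) × Linked NEStep (toList p)

IsRimHook : List ℕ → List⁺ Cell → Set
IsRimHook ps h =
  IsNEPath ps h × ¬ InΛ ps (sC (α h)) × ¬ InΛ ps (eC (ω h)) ×
  All (λ u → ¬ InΛ ps (eC (sC u))) (toList h)

-- the cell u with h = h^u : h^u runs from (λ'_j, j) to (i, λ_i), u = (i,j)
hookCell : List⁺ Cell → Cell
hookCell h = (row (ω h) , col (α h))

_<ʰ_ : List⁺ Cell → List⁺ Cell → Set
h <ʰ h' = hookCell h <ʳ hookCell h'

-- P(h, π): we only need its head α(P(h,π)) = v_s.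

pStep : List ℕ → (Cell → ℕ) → Cell → Cell
pStep ps π w =
  if (inB ps w ∨ inI ps w) ∧ (ext ps π w ==ᵛ ext ps π (sC w)) then sC w else wC w

pWalk : List ℕ → (Cell → ℕ) → ℕ → Cell → Cell
pWalk ps π zero    w = w
pWalk ps π (suc k) w = pWalk ps π k (pStep ps π w)

αP : List ℕ → (Cell → ℕ) → List⁺ Cell → Cell
αP ps π h = pWalk ps π (len h) (ω h)

isCand : List ℕ → (Cell → ℕ) → Cell → Bool
isCand ps π u =
  (inO ps u ∧ (ext ps π (wC u) <ᵛ ext ps π u)) ∨
  (inA ps u ∧ (ext ps π (wC u) <ᵛ ext ps π u) ∧ (ext ps π (nC u) <ᵛ ext ps π u))

Cand : List ℕ → (Cell → ℕ) → Cell → Set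
Cand ps π u = T (isCand ps π u)

data QAction : Set where
  north east stop stuck : QAction

qStep : List ℕ → (Cell → ℕ) → Cell → QAction
qStep ps π w =
  if (inO ps w ∨ inB ps w) ∧ (ext ps π w ==ᵛ ext ps π (nC w)) then north
  else (if (inI ps w ∨ inA ps w) ∨ (inλ ps (eC w) ∧ (ext ps π (nC w) <ᵛ ext ps π w)) then east
  else (if (ext ps π (nC w) <ᵛ ext ps π w) ∧ not (inλ ps (eC w)) then stop
  else stuck))

data QRun (ps : List ℕ) (π : Cell → ℕ) : Cell → List Cell → Set where
  qstop  : ∀ {w} → qStep ps π w ≡ stop → QRun ps π w []
  qnorth : ∀ {w rest} → qStep ps π w ≡ north → QRun ps π (nC w) rest →
           QRun ps π w (nC w ∷ rest)
  qeast  : ∀ {w rest} → qStep ps π w ≡ east → QRun ps π (eC w) rest →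
           QRun ps π w (eC w ∷ rest)

-- Q(v,π) = v ∷ rest  where QRun ps π v rest ;  h(v,π) is the rim-hook h'
-- with ω(h') = ω(Q(v,π)) and ℓ(h') = ℓ(Q(v,π)).
IsHookOfQ : List ℕ → (Cell → ℕ) → Cell → List⁺ Cell → Set
IsHookOfQ ps π v h' =
  Σ (List Cell) λ rest → QRun ps π v rest ×
    IsRimHook ps h' × (ω h' ≡ ω (v ∷ rest)) × (len h' ≡ length rest)

module Submission where

-- Let r be the cell of content c(u) at the bottom of its column on the rim; it exists
-- because u ∈ O ∪ A.  Then h(u,π) is the rim-hook from r to the last cell z of Q(u,π),
-- that is h(u,π) = h^(row z, col r), while h = h^(row ω(h), col α(h)), and P(h,π) ends at
-- a cell of the same content as α(h).  If c(u) > c(α(h)), the column bottom r lies to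
-- the right of α(h).  Otherwise r = α(h) and u lies strictly below α(P(h,π)) on the same
-- diagonal.  Running Q(u,π) forwards and P(h,π) backwards in lockstep keeps both on a
-- common diagonal with P strictly above Q: Q could only reach P by stepping north into
-- the cell x that P left westwards, but that north step needs π(x) = π(s x) and forces
-- x ∈ B ∪ I, so P would have stepped south from x.  Hence ω(h) lies above z.

open import Defs
open import Data.Nat using (ℕ)
open import Data.Product using (Σ; _×_)
open import Data.List.NonEmpty using (List⁺)

open import Data.Bool using (Bool; true; false; _∧_; _∨_; not; if_then_else_; T)
open import Data.Bool.Properties using (T-∧; T-∨; T-≡)
open import Data.Bool.ListAction using (any)
open import Data.Empty using (⊥; ⊥-elim)
open import Data.Unit using (tt)
open import Data.Product using (_,_; proj₁; proj₂; ∃)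
open import Data.Sum using (_⊎_; inj₁; inj₂)
open import Function using (_∘_; Equivalence; case_of_)
open import Relation.Binary.Definitions using (tri<; tri≈; tri>)
open import Relation.Binary.PropositionalEquality
open import Relation.Nullary using (¬_; yes; no)
open import Relation.Nullary.Decidable using (T?)

import Data.Nat as ℕ
open import Data.Nat using (zero; suc; z≤n; s≤s)
import Data.Nat.Properties as ℕP
import Data.Integer as ℤ
open import Data.Integer using (ℤ; +_; -[1+_]; _+_; _-_; -_; _≤_; _<_; _≤ᵇ_; +≤+; +<+; ∣_∣)
import Data.Integer.Properties as ℤP
open import Data.Integer.Tactic.RingSolver using (solve-∀)
open import Algebra.Properties.AbelianGroup ℤP.+-0-abelianGroup using (∙-cancelʳ)

open import Data.List
  using (List; []; _∷_; _++_; length; zip; drop; map; filterᵇ; applyUpTo; upTo; reverse; initLast; _∷ʳ′_)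
import Data.List.Properties as LP
open import Data.List.NonEmpty using (_∷_; last)
import Data.List.Relation.Unary.All as All
open import Data.List.Relation.Unary.All using (All; []; _∷_)
open import Data.List.Relation.Unary.All.Properties using (applyUpTo⁺₁)
open import Data.List.Relation.Unary.Linked using (Linked; []; [-]; _∷_)
open import Data.List.Relation.Unary.Sorted.TotalOrder.Properties using (↗↭↗⇒≋)
open import Data.List.Relation.Binary.Permutation.Propositional using (_↭_; ↭⇒↭ₛ; ↭-sym; ↭-trans)
open import Data.List.Relation.Binary.Permutation.Propositional.Properties using (↭-reverse)
open import Data.List.Relation.Binary.Pointwise using (Pointwise-≡⇒≡)
open import Data.List.Sort ℤP.≤-decTotalOrder using (sort; sort-↭; sort-↗)

private variable
  a b c d i j : ℤ

T-∧⁺ : ∀ {x y} → T x → T y → T (x ∧ y)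
T-∧⁺ p q = Equivalence.from T-∧ (p , q)

T-∧⁻ˡ : ∀ {x y} → T (x ∧ y) → T x
T-∧⁻ˡ {x} p = proj₁ (Equivalence.to (T-∧ {x}) p)

T-∧⁻ʳ : ∀ {x y} → T (x ∧ y) → T y
T-∧⁻ʳ {x} p = proj₂ (Equivalence.to (T-∧ {x}) p)

T-∨⁻ : ∀ {x y} → T (x ∨ y) → T x ⊎ T y
T-∨⁻ {x} = Equivalence.to (T-∨ {x})

T-∨⁺ˡ : ∀ {x y} → T x → T (x ∨ y)
T-∨⁺ˡ p = Equivalence.from T-∨ (inj₁ p)

T-∨⁺ʳ : ∀ {x y} → T y → T (x ∨ y)
T-∨⁺ʳ {x} p = Equivalence.from (T-∨ {x}) (inj₂ p)

T-not⁺ : ∀ {x} → ¬ T x → T (not x)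
T-not⁺ {true}  ¬p = ¬p tt
T-not⁺ {false} _  = tt

T-not⁻ : ∀ {x} → T (not x) → ¬ T x
T-not⁻ {true} () _

<⇒+1≤ : a < b → a + + 1 ≤ b
<⇒+1≤ {a} p = subst (_≤ _) (ℤP.+-comm (+ 1) a) (ℤP.i<j⇒suc[i]≤j p)

+1≤⇒< : a + + 1 ≤ b → a < b
+1≤⇒< {a} p = ℤP.suc[i]≤j⇒i<j (subst (_≤ _) (ℤP.+-comm a (+ 1)) p)

i<i+1 : ∀ i → i < i + + 1
i<i+1 i = +1≤⇒< ℤP.≤-refl

i-1<i : ∀ i → i - + 1 < i
i-1<i i = subst (i - + 1 <_) (cancel i) (i<i+1 (i - + 1))
  where cancel : ∀ i → i - + 1 + + 1 ≡ i
        cancel = solve-∀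

≤⇒≤+1 : a ≤ b → a ≤ b + + 1
≤⇒≤+1 {b = b} p = ℤP.≤-trans p (ℤP.i≤i+j b (+ 1))

<+1⇒≤ : a < b + + 1 → a ≤ b
<+1⇒≤ p = ℤP.≮⇒≥ (λ b<a → ℤP.<-irrefl refl (ℤP.<-≤-trans p (<⇒+1≤ b<a)))

<⇒≤-1 : a < b → a ≤ b - + 1
<⇒≤-1 {a} {b} p = subst (_≤ b - + 1) (cancel a) (ℤP.+-monoˡ-≤ (- + 1) (<⇒+1≤ p))
  where cancel : ∀ a → a + + 1 - + 1 ≡ a
        cancel = solve-∀

-<⇒<+ : a - b < c → a < c + b
-<⇒<+ {a} {b} {c} p = subst (_< c + b) (cancel a b) (ℤP.+-monoˡ-< b p)
  where cancel : ∀ a b → a - b + b ≡ a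
        cancel = solve-∀

≤-⇒+≤ : c ≤ a - b → c + b ≤ a
≤-⇒+≤ {c} {a} {b} p = subst (c + b ≤_) (cancel a b) (ℤP.+-monoˡ-≤ b p)
  where cancel : ∀ a b → a - b + b ≡ a
        cancel = solve-∀

i≤+∣i∣ : ∀ i → i ≤ + ∣ i ∣
i≤+∣i∣ (+ _)      = ℤP.≤-refl
i≤+∣i∣ -[1+ _ ] = ℤ.-≤+

sub-mono-≤ : a ≤ b → d ≤ c → a - c ≤ b - d
sub-mono-≤ p q = ℤP.+-mono-≤ p (ℤP.neg-mono-≤ q)

sub-mono-<-≤ : a < b → d ≤ c → a - c < b - d
sub-mono-<-≤ p q = ℤP.+-mono-<-≤ p (ℤP.neg-mono-≤ q)

sub-mono-≤-< : a ≤ b → d < c → a - c < b - d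
sub-mono-≤-< p q = ℤP.+-mono-≤-< p (ℤP.neg-mono-< q)

+suc≡+1+ : ∀ i n → i + + suc n ≡ (i + + 1) + + n
+suc≡+1+ i n = trans (cong (λ t → i + t) (ℤP.pos-+ 1 n)) (sym (ℤP.+-assoc i (+ 1) (+ n)))

i<i+suc : ∀ i n → i < i + + suc n
i<i+suc i n = subst (_< i + + suc n) (ℤP.+-identityʳ i) (ℤP.+-monoʳ-< i (+<+ (s≤s z≤n)))

content-mono-≤ : a ≤ i → j ≤ b → content (i , j) ≤ content (a , b)
content-mono-≤ p q = sub-mono-≤ q p

content-mono-<₁ : a < i → j ≤ b → content (i , j) < content (a , b)
content-mono-<₁ p q = sub-mono-≤-< q p

content-mono-<₂ : a ≤ i → j < b → content (i , j) < content (a , b)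
content-mono-<₂ p q = sub-mono-<-≤ q p

content-injective-row : content (i , j) ≡ content (i , b) → j ≡ b
content-injective-row {i} {j} {b} = ∙-cancelʳ (- i) j b

sameContent-row<⇒col< : content (i , j) ≡ content (a , b) → i < a → j < b
sameContent-row<⇒col< e i<a =
  ℤP.≰⇒> (λ b≤j → ℤP.<-irrefl (sym e) (content-mono-<₁ i<a b≤j))

cell-≡ : ∀ {u v} → row u ≡ row v → content u ≡ content v → u ≡ v
cell-≡ {i , j} {.i , b} refl e = cong (i ,_) (content-injective-row e)

content<-col≤⇒row< : content (i , j) < content (a , b) → b ≤ j → a < i
content<-col≤⇒row< lt b≤j = ℤP.≰⇒> (λ i≤a → ℤP.<⇒≱ lt (content-mono-≤ i≤a b≤j))

content-nC : ∀ u → content (nC u) ≡ content u + + 1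
content-nC (i , j) = lemma i j
  where lemma : ∀ i j → j - (i - + 1) ≡ (j - i) + + 1
        lemma = solve-∀

content-eC : ∀ u → content (eC u) ≡ content u + + 1
content-eC (i , j) = lemma i j
  where lemma : ∀ i j → (j + + 1) - i ≡ (j - i) + + 1
        lemma = solve-∀

content-sC : ∀ u → content (sC u) ≡ content u - + 1
content-sC (i , j) = lemma i j
  where lemma : ∀ i j → j - (i + + 1) ≡ (j - i) - + 1
        lemma = solve-∀

content-wC : ∀ u → content (wC u) ≡ content u - + 1
content-wC (i , j) = lemma i j
  where lemma : ∀ i j → (j - + 1) - i ≡ (j - i) - + 1
        lemma = solve-∀

sC∘nC : ∀ u → sC (nC u) ≡ u
sC∘nC (i , j) = cong (_, j) (lemma i)
  where lemma : ∀ i → i - + 1 + + 1 ≡ i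
        lemma = solve-∀

0≤ᵛ : ∀ v → T (fin 0 ≤ᵛ v)
0≤ᵛ (fin _) = tt
0≤ᵛ ∞       = tt

≤ᵛ-trans : ∀ u v w → T (u ≤ᵛ v) → T (v ≤ᵛ w) → T (u ≤ᵛ w)
≤ᵛ-trans (fin a) (fin b) (fin c) p q = ℕP.≤⇒≤ᵇ (ℕP.≤-trans (ℕP.≤ᵇ⇒≤ a b p) (ℕP.≤ᵇ⇒≤ b c q))
≤ᵛ-trans (fin _) (fin _) ∞       _ _ = tt
≤ᵛ-trans (fin _) ∞       ∞       _ _ = tt
≤ᵛ-trans ∞       ∞       ∞       _ _ = tt

<ᵛ-≤ᵛ-trans : ∀ u v w → T (u <ᵛ v) → T (v ≤ᵛ w) → T (u <ᵛ w)
<ᵛ-≤ᵛ-trans u v w p q = T-not⁺ (λ w≤u → T-not⁻ p (≤ᵛ-trans v w u q w≤u))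

≤ᵛ-<ᵛ-trans : ∀ u v w → T (u ≤ᵛ v) → T (v <ᵛ w) → T (u <ᵛ w)
≤ᵛ-<ᵛ-trans u v w p q = T-not⁺ (λ w≤u → T-not⁻ q (≤ᵛ-trans w u v w≤u p))

==ᵛ-sym : ∀ u v → T (u ==ᵛ v) → T (v ==ᵛ u)
==ᵛ-sym u v p = T-∧⁺ (T-∧⁻ʳ {u ≤ᵛ v} p) (T-∧⁻ˡ {u ≤ᵛ v} p)

NEStep-content : ∀ {u v} → NEStep u v → content v ≡ content u + + 1
NEStep-content {u} (inj₁ refl) = content-nC u
NEStep-content {u} (inj₂ refl) = content-eC u

last-∷ : ∀ {A : Set} (x y : A) ys → last (x ∷ y ∷ ys) ≡ last (y ∷ ys)
last-∷ x y ys with initLast ys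
... | []      = refl
... | _ ∷ʳ′ _ = refl

All-last : ∀ {A : Set} {P : A → Set} x xs → All P (x ∷ xs) → P (last (x ∷ xs))
All-last x []       (px ∷ []) = px
All-last {P = P} x (y ∷ ys) (_ ∷ pys) = subst P (sym (last-∷ x y ys)) (All-last y ys pys)

NEPath-content : ∀ x xs → Linked NEStep (x ∷ xs) → content (last (x ∷ xs)) ≡ content x + + length xs
NEPath-content x []       _        = sym (ℤP.+-identityʳ (content x))
NEPath-content x (y ∷ ys) (st ∷ l) = begin
  content (last (x ∷ y ∷ ys))   ≡⟨ cong content (last-∷ x y ys) ⟩
  content (last (y ∷ ys))       ≡⟨ NEPath-content y ys l ⟩
  content y + + length ys       ≡⟨ cong (_+ + length ys) (NEStep-content st) ⟩
  content x + + 1 + + length ys ≡⟨ sym (+suc≡+1+ (content x) (length ys)) ⟩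
  content x + + suc (length ys) ∎
  where open ≡-Reasoning

-- The Young diagram and its rim

nth≤head : ∀ {k ks} → Linked ℕ._≥_ (k ∷ ks) → ∀ n → nth (k ∷ ks) n ℕ.≤ k
nth≤head _          zero    = ℕP.≤-refl
nth≤head [-]        (suc n) = z≤n
nth≤head (k≥k' ∷ l) (suc n) = ℕP.≤-trans (nth≤head l n) k≥k'

nth-antitone : ∀ {ms} → Linked ℕ._≥_ ms → ∀ {m n} → m ℕ.≤ n → nth ms n ℕ.≤ nth ms m
nth-antitone {[]}    _ _ = z≤n
nth-antitone {_ ∷ _} l {zero} {n} _ = nth≤head l n
nth-antitone {_ ∷ _} [-]     {suc m} {suc n} _ = z≤n
nth-antitone {_ ∷ _} (_ ∷ l) {suc m} {suc n} (s≤s m≤n) = nth-antitone l m≤n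

record RimCell (ps : List ℕ) (r : Cell) : Set where
  constructor rimCell
  field
    ∈λ       : InΛ ps r
    eC∘sC-∉λ : ¬ InΛ ps (eC (sC r))

record ColumnBottom (ps : List ℕ) (r : Cell) : Set where
  constructor columnBottom
  field
    ∈λ    : InΛ ps r
    sC-∉λ : ¬ InΛ ps (sC r)

module Diagram (ps : List ℕ) (dec : Linked ℕ._≥_ ps) where

  L : ℤ → ℕ
  L = rowLen ps

  rowLen-antitone : ∀ {i i'} → + 1 ≤ i → i ≤ i' → L i' ℕ.≤ L i
  rowLen-antitone {+ suc _} {+ suc _} _ (+≤+ (s≤s a≤a')) = nth-antitone dec a≤a'
  rowLen-antitone {+ suc _} {+ zero}  _ (+≤+ ())
  rowLen-antitone {+ zero} (+≤+ ())

  ∈λ⁺ : ∀ u → + 1 ≤ col u → col u ≤ + L (row u) → InΛ ps u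
  ∈λ⁺ _ p q = T-∧⁺ (ℤP.≤⇒≤ᵇ p) (ℤP.≤⇒≤ᵇ q)

  ∈λ⇒1≤col : ∀ u → InΛ ps u → + 1 ≤ col u
  ∈λ⇒1≤col (i , j) p = ℤP.≤ᵇ⇒≤ (T-∧⁻ˡ {+ 1 ≤ᵇ j} p)

  ∈λ⇒col≤rowLen : ∀ u → InΛ ps u → col u ≤ + L (row u)
  ∈λ⇒col≤rowLen (i , j) p = ℤP.≤ᵇ⇒≤ (T-∧⁻ʳ {+ 1 ≤ᵇ j} p)

  ∈λ⇒1≤row : ∀ u → InΛ ps u → + 1 ≤ row u
  ∈λ⇒1≤row (+ suc _ , _) _ = +≤+ (s≤s z≤n)
  ∈λ⇒1≤row u@(+ zero , _) p with ℤP.≤-trans (∈λ⇒1≤col u p) (∈λ⇒col≤rowLen u p)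
  ... | +≤+ ()
  ∈λ⇒1≤row u@(-[1+ _ ] , _) p with ℤP.≤-trans (∈λ⇒1≤col u p) (∈λ⇒col≤rowLen u p)
  ... | +≤+ ()

  ∈λ-downClosed : ∀ u {v} → InΛ ps v → + 1 ≤ row u → row u ≤ row v → + 1 ≤ col u → col u ≤ col v → InΛ ps u
  ∈λ-downClosed u {v} p 1≤i i≤a 1≤j j≤b =
    ∈λ⁺ u 1≤j (ℤP.≤-trans j≤b (ℤP.≤-trans (∈λ⇒col≤rowLen v p) (+≤+ (rowLen-antitone 1≤i i≤a))))

  nC-∈λ : ∀ v → InΛ ps v → + 1 ≤ row v - + 1 → InΛ ps (nC v)
  nC-∈λ v p q = ∈λ-downClosed (nC v) p q (ℤP.<⇒≤ (i-1<i (row v))) (∈λ⇒1≤col v p) ℤP.≤-refl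

  eC-∉λ⇒rowLen≤col : ∀ v → InΛ ps v → ¬ InΛ ps (eC v) → + L (row v) ≤ col v
  eC-∉λ⇒rowLen≤col v p e∉ =
    <+1⇒≤ (ℤP.≰⇒> (λ le → e∉ (∈λ⁺ (eC v) (≤⇒≤+1 (∈λ⇒1≤col v p)) le)))

  rim-noCellSouthEast : ∀ {r} → RimCell ps r → ∀ x → InΛ ps x → row r < row x → col r < col x → ⊥
  rim-noCellSouthEast {r} (rimCell r∈ es∉) x x∈ p q =
    es∉ (∈λ-downClosed (eC (sC r)) x∈ (≤⇒≤+1 (∈λ⇒1≤row r r∈)) (<⇒+1≤ p) (≤⇒≤+1 (∈λ⇒1≤col r r∈)) (<⇒+1≤ q))

  rim-content-injective : ∀ {u v} → RimCell ps u → RimCell ps v → content u ≡ content v → u ≡ v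
  rim-content-injective {i , j} {a , b} ru rv e with ℤP.<-cmp i a
  ... | tri< i<a _ _ = ⊥-elim (rim-noCellSouthEast ru (a , b) (RimCell.∈λ rv) i<a (sameContent-row<⇒col< e i<a))
  ... | tri≈ _ refl _ = cong (i ,_) (content-injective-row e)
  ... | tri> _ _ a<i = ⊥-elim (rim-noCellSouthEast rv (i , j) (RimCell.∈λ ru) a<i (sameContent-row<⇒col< (sym e) a<i))

  columnBottom⇒rim : ∀ {r} → ColumnBottom ps r → RimCell ps r
  columnBottom⇒rim {r} (columnBottom r∈ s∉) = rimCell r∈ λ es∈ →
    s∉ (∈λ-downClosed (sC r) es∈ (≤⇒≤+1 (∈λ⇒1≤row r r∈)) ℤP.≤-refl (∈λ⇒1≤col r r∈) (≤⇒≤+1 ℤP.≤-refl))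

  columnBottom-col< : ∀ {r} → ColumnBottom ps r → ∀ x → InΛ ps x → content x < content r → col x < col r
  columnBottom-col< {r} (columnBottom r∈ s∉) x x∈ lt = ℤP.≰⇒> λ r≤x →
    s∉ (∈λ-downClosed (sC r) x∈ (≤⇒≤+1 (∈λ⇒1≤row r r∈)) (<⇒+1≤ (content<-col≤⇒row< lt r≤x)) (∈λ⇒1≤col r r∈) r≤x)

  rimSucc : Cell → Cell
  rimSucc v = if inλ ps (eC v) then eC v else nC v

  rimSucc-step : ∀ {v z} → RimCell ps v → RimCell ps z → content v < content z →
                 RimCell ps (rimSucc v) × NEStep v (rimSucc v)
  rimSucc-step {v} {z} (rimCell v∈ es∉) (rimCell z∈ _) lt with inλ ps (eC v) in e∈?
  ... | true = rimCell (Equivalence.from T-≡ e∈?) es∉′ , inj₂ refl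
    where
    es∉′ : ¬ InΛ ps (eC (sC (eC v)))
    es∉′ p = es∉ (∈λ-downClosed (eC (sC v)) p (≤⇒≤+1 (∈λ⇒1≤row v v∈)) ℤP.≤-refl
                                 (≤⇒≤+1 (∈λ⇒1≤col v v∈)) (≤⇒≤+1 ℤP.≤-refl))
  ... | false = rimCell n∈ (λ p → e∉ (subst (InΛ ps) (cong eC (sC∘nC v)) p)) , inj₁ refl
    where
    e∉ : ¬ InΛ ps (eC v)
    e∉ p = subst T e∈? p
    z-above : row z < row v
    z-above = ℤP.≰⇒> λ v≤z → ℤP.<⇒≱ lt (content-mono-≤ v≤z
      (ℤP.≤-trans (∈λ⇒col≤rowLen z z∈)
        (ℤP.≤-trans (+≤+ (rowLen-antitone (∈λ⇒1≤row v v∈) v≤z)) (eC-∉λ⇒rowLen≤col v v∈ e∉))))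
    n∈ : InΛ ps (nC v)
    n∈ = nC-∈λ v v∈ (ℤP.≤-trans (∈λ⇒1≤row z z∈) (<⇒≤-1 z-above))

  rimPath : ℕ → Cell → List Cell
  rimPath zero    v = []
  rimPath (suc n) v = rimSucc v ∷ rimPath n (rimSucc v)

  length-rimPath : ∀ n v → length (rimPath n v) ≡ n
  length-rimPath zero    v = refl
  length-rimPath (suc n) v = cong suc (length-rimPath n (rimSucc v))

  rimPath-reaches : ∀ n {v z} → RimCell ps v → RimCell ps z → content v + + n ≡ content z →
    All (RimCell ps) (rimPath n v) × Linked NEStep (v ∷ rimPath n v) × last (v ∷ rimPath n v) ≡ z
  rimPath-reaches zero    {v} rv rz e =
    [] , [-] , rim-content-injective rv rz (trans (sym (ℤP.+-identityʳ (content v))) e)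
  rimPath-reaches (suc n) {v} {z} rv rz e
    with rimSucc-step rv rz (subst (content v <_) e (i<i+suc (content v) n))
  ... | rv′ , st with rimPath-reaches n rv′ rz (trans (cong (_+ + n) (NEStep-content st))
                                                      (trans (sym (+suc≡+1+ (content v) n)) e))
  ...   | rims , path , ends = rv′ ∷ rims , st ∷ path , trans (last-∷ v (rimSucc v) (rimPath n (rimSucc v))) ends

  rowEnd⇒rim : ∀ {z} → InΛ ps z → ¬ InΛ ps (eC z) → RimCell ps z
  rowEnd⇒rim {z} z∈ e∉ = rimCell z∈ λ es∈ →
    e∉ (∈λ-downClosed (eC z) es∈ (∈λ⇒1≤row z z∈) (≤⇒≤+1 ℤP.≤-refl) (≤⇒≤+1 (∈λ⇒1≤col z z∈)) ℤP.≤-refl)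

  rimHook-head : ∀ {h} → IsRimHook ps h → ColumnBottom ps (α h)
  rimHook-head {_ ∷ _} ((h∈ ∷ _ , _) , s∉ , _) = columnBottom h∈ s∉

  rimHook-last : ∀ {h} → IsRimHook ps h → RimCell ps (ω h)
  rimHook-last {x ∷ xs} ((all∈ , _) , _ , e∉ , _) = rowEnd⇒rim (All-last x xs all∈) e∉

  rimHook-content : ∀ {h} → IsRimHook ps h → content (ω h) ≡ content (α h) + + len h
  rimHook-content {x ∷ xs} ((_ , path) , _) = NEPath-content x xs path

  rimHook-fromTo : ∀ n {r z} → ColumnBottom ps r → InΛ ps z → ¬ InΛ ps (eC z) → content r + + n ≡ content z →
    IsRimHook ps (r ∷ rimPath n r) × ω (r ∷ rimPath n r) ≡ z × len (r ∷ rimPath n r) ≡ n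
  rimHook-fromTo n {r} {z} r-bottom z∈ e∉ e
    with rimPath-reaches n (columnBottom⇒rim r-bottom) (rowEnd⇒rim z∈ e∉) e
  ... | rims , path , ends =
    ((ColumnBottom.∈λ r-bottom ∷ All.map RimCell.∈λ rims , path) ,
     ColumnBottom.sC-∉λ r-bottom , subst (λ y → ¬ InΛ ps (eC y)) (sym ends) e∉ ,
     RimCell.eC∘sC-∉λ (columnBottom⇒rim r-bottom) ∷ All.map RimCell.eC∘sC-∉λ rims) ,
    ends , length-rimPath n r

-- Interlacing sequences and the regions A and B

<ᶻ⇒< : T (a <ᶻ b) → a < b
<ᶻ⇒< p = +1≤⇒< (ℤP.≤ᵇ⇒≤ p)

<⇒<ᶻ : a < b → T (a <ᶻ b)
<⇒<ᶻ p = ℤP.≤⇒≤ᵇ (<⇒+1≤ p)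

==ᶻ⇒≡ : T (a ==ᶻ b) → a ≡ b
==ᶻ⇒≡ {a} p = ℤP.≤-antisym (ℤP.≤ᵇ⇒≤ (T-∧⁻ˡ {a ≤ᵇ _} p)) (ℤP.≤ᵇ⇒≤ (T-∧⁻ʳ {a ≤ᵇ _} p))

==ᶻ-refl : ∀ a → T (a ==ᶻ a)
==ᶻ-refl a = T-∧⁺ {a ≤ᵇ a} (ℤP.≤⇒≤ᵇ {a} ℤP.≤-refl) (ℤP.≤⇒≤ᵇ {a} ℤP.≤-refl)

-- inA ps u and inB ps u unfold to inλ ps u ∧ aRegion (content u) os is, resp. bRegion,
-- with os = outerContents ps and is = innerContents ps.
strictlyBetween : ℤ → ℤ × ℤ → Bool
strictlyBetween c p = (proj₁ p <ᶻ c) ∧ (c <ᶻ proj₂ p)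

aRegion bRegion : ℤ → List ℤ → List ℤ → Bool
aRegion c os is = (c <ᶻ headOr os) ∨ any (strictlyBetween c) (zip is (drop 1 os))
bRegion c os is = any (strictlyBetween c) (zip os is) ∨ (lastOr os <ᶻ c)

data Region (c : ℤ) (os is : List ℤ) : Set where
  regionA : T (aRegion c os is) → Region c os is
  regionB : T (bRegion c os is) → Region c os is
  atOuter : T (elemᶻ c os)      → Region c os is
  atInner : T (elemᶻ c is)      → Region c os is

data Interlacing (R : ℤ → ℤ → Set) : List ℤ → List ℤ → Set where
  single : ∀ o → Interlacing R (o ∷ []) []
  cons   : ∀ {o i os is} → o < i → i < headOr os → R i (headOr os) →
           Interlacing R os is → Interlacing R (o ∷ os) (i ∷ is)

-- An interlacing listed in decreasing order, as the rows of a partition produce it from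
-- the top; B holds of its smallest outer content.
data DescInterlacing (R : ℤ → ℤ → Set) (B : ℤ → Set) : List ℤ → List ℤ → Set where
  single : ∀ {o} → B o → DescInterlacing R B (o ∷ []) []
  cons   : ∀ {o i ol il} → i < o → headOr ol < i → R i o →
           DescInterlacing R B ol il → DescInterlacing R B (o ∷ ol) (i ∷ il)

lastOr-∷ʳ : ∀ ys x → lastOr (ys ++ x ∷ []) ≡ x
lastOr-∷ʳ []           x = refl
lastOr-∷ʳ (_ ∷ [])     x = refl
lastOr-∷ʳ (_ ∷ y ∷ ys) x = lastOr-∷ʳ (y ∷ ys) x

lastOr-reverse : ∀ xs → lastOr (reverse xs) ≡ headOr xs
lastOr-reverse []       = refl
lastOr-reverse (x ∷ xs) = trans (cong lastOr (LP.unfold-reverse x xs)) (lastOr-∷ʳ (reverse xs) x)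

headOr-reverse : ∀ xs → headOr (reverse xs) ≡ lastOr xs
headOr-reverse xs = trans (sym (lastOr-reverse (reverse xs))) (cong lastOr (LP.reverse-involutive xs))

sort-unique : ∀ xs ys → Linked _≤_ ys → ys ↭ xs → sort xs ≡ ys
sort-unique xs ys ys↗ ys↭xs = Pointwise-≡⇒≡
  (↗↭↗⇒≋ ℤP.≤-totalOrder (sort-↗ xs) ys↗ (↭⇒↭ₛ (↭-trans (sort-↭ xs) (↭-sym ys↭xs))))

module _ {R : ℤ → ℤ → Set} where

  lastOr-∷ : ∀ {o os is} → Interlacing R os is → lastOr (o ∷ os) ≡ lastOr os
  lastOr-∷ (single _)     = refl
  lastOr-∷ (cons _ _ _ _) = refl

  zip-∷ : ∀ {i : ℤ} {is os is′} → Interlacing R os is′ → zip (i ∷ is) os ≡ (i , headOr os) ∷ zip is (drop 1 os)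
  zip-∷ (single _)     = refl
  zip-∷ (cons _ _ _ _) = refl

  headOr-∷ʳ : ∀ {os is} → Interlacing R os is → ∀ o → headOr (os ++ o ∷ []) ≡ headOr os
  headOr-∷ʳ (single _)     _ = refl
  headOr-∷ʳ (cons _ _ _ _) _ = refl

  Interlacing-∷ʳ : ∀ {os is i o} → Interlacing R os is → lastOr os < i → i < o → R i o →
                   Interlacing R (os ++ o ∷ []) (is ++ i ∷ [])
  Interlacing-∷ʳ {o = o} (single _) p q r = cons p q r (single o)
  Interlacing-∷ʳ {i = i} {o} (cons {o′} {i′} a b c rest) p q r =
    cons a (subst (i′ <_) (sym (headOr-∷ʳ rest o)) b) (subst (R i′) (sym (headOr-∷ʳ rest o)) c)
         (Interlacing-∷ʳ rest (subst (_< i) (lastOr-∷ {o = o′} rest) p) q r)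

  reverse-interlacing : ∀ {B ol il} → DescInterlacing R B ol il → Interlacing R (reverse ol) (reverse il)
  reverse-interlacing (single {o} _) = single o
  reverse-interlacing (cons {o} {i} {ol} {il} i<o next<i r rest)
    rewrite LP.unfold-reverse o ol | LP.unfold-reverse i il =
    Interlacing-∷ʳ (reverse-interlacing rest) (subst (_< i) (sym (lastOr-reverse ol)) next<i) i<o r

  descInterlacing-last : ∀ {B ol il} → DescInterlacing R B ol il → B (lastOr ol)
  descInterlacing-last (single b) = b
  descInterlacing-last (cons _ _ _ rest@(single _))     = descInterlacing-last rest
  descInterlacing-last (cons _ _ _ rest@(cons _ _ _ _)) = descInterlacing-last rest

  ≤-headOr⇒Linked : ∀ {o os is} → Interlacing R os is → o ≤ headOr os → Linked _≤_ os → Linked _≤_ (o ∷ os)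
  ≤-headOr⇒Linked (single _)     p l = p ∷ l
  ≤-headOr⇒Linked (cons _ _ _ _) p l = p ∷ l

  Interlacing-outer↗ : ∀ {os is} → Interlacing R os is → Linked _≤_ os
  Interlacing-outer↗ (single _)          = [-]
  Interlacing-outer↗ (cons o<i i<o′ _ rest) =
    ≤-headOr⇒Linked rest (ℤP.<⇒≤ (ℤP.<-trans o<i i<o′)) (Interlacing-outer↗ rest)

  Interlacing-inner↗ : ∀ {os is} → Interlacing R os is → Linked _≤_ is
  Interlacing-inner↗ (single _)                            = []
  Interlacing-inner↗ (cons _ _ _ (single _))               = [-]
  Interlacing-inner↗ (cons _ i<o′ _ rest@(cons o′<i′ _ _ _)) =
    ℤP.<⇒≤ (ℤP.<-trans i<o′ o′<i′) ∷ Interlacing-inner↗ rest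

  region-∷ : ∀ {c o i y ys is} → i < c → Region c (y ∷ ys) is → Region c (o ∷ y ∷ ys) (i ∷ is)
  region-∷ {c} {o} {i} {y} {ys} {is} i<c (regionA p) with T-∨⁻ {c <ᶻ y} p
  ... | inj₁ c<y = regionA (T-∨⁺ʳ {c <ᶻ o} (T-∨⁺ˡ (T-∧⁺ {i <ᶻ c} (<⇒<ᶻ i<c) c<y)))
  ... | inj₂ q   = regionA (T-∨⁺ʳ {c <ᶻ o} (T-∨⁺ʳ {strictlyBetween c (i , y)} q))
  region-∷ {c} {o} {i} {y} {ys} {is} i<c (regionB p) with T-∨⁻ {any (strictlyBetween c) (zip (y ∷ ys) is)} p
  ... | inj₁ q = regionB (T-∨⁺ˡ (T-∨⁺ʳ {strictlyBetween c (o , i)} q))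
  ... | inj₂ q = regionB (T-∨⁺ʳ {any (strictlyBetween c) (zip (o ∷ y ∷ ys) (i ∷ is))} q)
  region-∷ {c} {o} _ (atOuter p) = atOuter (T-∨⁺ʳ {c ==ᶻ o} p)
  region-∷ {c} {i = i} _ (atInner p) = atInner (T-∨⁺ʳ {c ==ᶻ i} p)

  region-cons : ∀ {c o i os is} → i < c → Interlacing R os is → Region c os is → Region c (o ∷ os) (i ∷ is)
  region-cons i<c (single _)     = region-∷ i<c
  region-cons i<c (cons _ _ _ _) = region-∷ i<c

  region-cover : ∀ {os is} → Interlacing R os is → ∀ c → Region c os is
  region-cover (single o) c with ℤP.<-cmp c o
  ... | tri< c<o _ _  = regionA (T-∨⁺ˡ (<⇒<ᶻ c<o))
  ... | tri≈ _ refl _ = atOuter (T-∨⁺ˡ (==ᶻ-refl c))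
  ... | tri> _ _ o<c  = regionB (<⇒<ᶻ o<c)
  region-cover (cons {o} {i} _ _ _ rest) c with ℤP.<-cmp c o
  ... | tri< c<o _ _  = regionA (T-∨⁺ˡ (<⇒<ᶻ c<o))
  ... | tri≈ _ refl _ = atOuter (T-∨⁺ˡ (==ᶻ-refl c))
  ... | tri> _ _ o<c with ℤP.<-cmp c i
  ...   | tri< c<i _ _  = regionB (T-∨⁺ˡ (T-∨⁺ˡ (T-∧⁺ (<⇒<ᶻ o<c) (<⇒<ᶻ c<i))))
  ...   | tri≈ _ refl _ = atInner (T-∨⁺ˡ (==ᶻ-refl c))
  ...   | tri> _ _ i<c  = region-cons i<c rest (region-cover rest c)

  BI-∷ : ∀ {d o i os is} → Interlacing R os is → T (bRegion d os is) ⊎ T (elemᶻ d is) →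
         T (bRegion d (o ∷ os) (i ∷ is)) ⊎ T (elemᶻ d (i ∷ is))
  BI-∷ {d} {o} {i} {os} {is} rest (inj₁ b) with T-∨⁻ {any (strictlyBetween d) (zip os is)} b
  ... | inj₁ q = inj₁ (T-∨⁺ˡ (T-∨⁺ʳ {strictlyBetween d (o , i)} q))
  ... | inj₂ q = inj₁ (T-∨⁺ʳ {any (strictlyBetween d) (zip (o ∷ os) (i ∷ is))}
                             (subst (λ l → T (l <ᶻ d)) (sym (lastOr-∷ {o = o} rest)) q))
  BI-∷ {d} {i = i} _ (inj₂ q) = inj₂ (T-∨⁺ʳ {d ==ᶻ i} q)

  BI-afterOuter : ∀ {c o i os is} → o ≤ c → c < i →
                  T (bRegion (c + + 1) (o ∷ os) (i ∷ is)) ⊎ T (elemᶻ (c + + 1) (i ∷ is))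
  BI-afterOuter {c} {o} {i} o≤c c<i with ℤP.<-cmp (c + + 1) i
  ... | tri< c+1<i _ _ = inj₁ (T-∨⁺ˡ (T-∨⁺ˡ (T-∧⁺ {o <ᶻ (c + + 1)}
                            (<⇒<ᶻ (ℤP.≤-<-trans o≤c (i<i+1 c))) (<⇒<ᶻ c+1<i))))
  ... | tri≈ _ refl _  = inj₂ (T-∨⁺ˡ (==ᶻ-refl (c + + 1)))
  ... | tri> _ _ i<c+1 = ⊥-elim (ℤP.<-irrefl refl (ℤP.<-≤-trans c<i (<+1⇒≤ i<c+1)))

  OB-content-suc : ∀ {c os is} → Interlacing R os is → T (elemᶻ c os) ⊎ T (bRegion c os is) →
                   T (bRegion (c + + 1) os is) ⊎ T (elemᶻ (c + + 1) is)
  OB-content-suc {c} (single o) (inj₁ p) with T-∨⁻ {c ==ᶻ o} p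
  ... | inj₁ c≡o = inj₁ (<⇒<ᶻ (subst (_< c + + 1) (==ᶻ⇒≡ c≡o) (i<i+1 c)))
  OB-content-suc {c} (single o) (inj₂ p) = inj₁ (<⇒<ᶻ (ℤP.<-trans (<ᶻ⇒< {o} p) (i<i+1 c)))
  OB-content-suc {c} (cons {o} {i} {os} {is} o<i _ _ rest) (inj₁ p) with T-∨⁻ {c ==ᶻ o} p
  ... | inj₁ c≡o = BI-afterOuter {c} {o} {i} {os} {is}
                     (ℤP.≤-reflexive (sym (==ᶻ⇒≡ c≡o))) (subst (_< i) (sym (==ᶻ⇒≡ c≡o)) o<i)
  ... | inj₂ q   = BI-∷ {c + + 1} {o} {i} rest (OB-content-suc rest (inj₁ q))
  OB-content-suc {c} (cons {o} {i} {os} {is} _ _ _ rest) (inj₂ p)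
    with T-∨⁻ {any (strictlyBetween c) (zip (o ∷ os) (i ∷ is))} p
  ... | inj₂ q = BI-∷ {c + + 1} {o} {i} rest (OB-content-suc rest (inj₂ (T-∨⁺ʳ {any (strictlyBetween c) (zip os is)}
                                                      (subst (λ l → T (l <ᶻ c)) (lastOr-∷ {o = o} rest) q))))
  ... | inj₁ q with T-∨⁻ {strictlyBetween c (o , i)} q
  ...   | inj₁ o<c<i = BI-afterOuter {c} {o} {i} {os} {is}
                         (ℤP.<⇒≤ (<ᶻ⇒< (T-∧⁻ˡ {o <ᶻ c} o<c<i))) (<ᶻ⇒< (T-∧⁻ʳ {o <ᶻ c} o<c<i))
  ...   | inj₂ q′    = BI-∷ {c + + 1} {o} {i} rest (OB-content-suc rest (inj₂ (T-∨⁺ˡ q′)))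

  strictlyBetween⇒ : ∀ {c i o} → T (strictlyBetween c (i , o)) → i < c × c < o
  strictlyBetween⇒ {c} {i} p = <ᶻ⇒< {i} (T-∧⁻ˡ {i <ᶻ c} p) , <ᶻ⇒< {c} (T-∧⁻ʳ {i <ᶻ c} p)

  A-pairs-witness : ∀ {c os is} → Interlacing R os is → T (any (strictlyBetween c) (zip is (drop 1 os))) →
                    ∃ λ i → ∃ λ o → R i o × i < c × c < o
  A-pairs-witness {c} (cons {i = i} {os} {is} _ _ r rest) p
    with T-∨⁻ {strictlyBetween c (i , headOr os)} (subst (T ∘ any (strictlyBetween c)) (zip-∷ {i = i} {is = is} rest) p)
  ... | inj₁ q = i , headOr os , r , strictlyBetween⇒ q
  ... | inj₂ q = A-pairs-witness rest q

  A-content-witness : ∀ {c os is} → Interlacing R os is → T (aRegion c os is) →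
                      c < headOr os ⊎ ∃ λ i → ∃ λ o → R i o × i < c × c < o
  A-content-witness {c} {os} il p with T-∨⁻ {c <ᶻ headOr os} p
  ... | inj₁ q = inj₁ (<ᶻ⇒< {c} q)
  ... | inj₂ q = inj₂ (A-pairs-witness il q)

  inner-witness : ∀ {c os is} → Interlacing R os is → T (elemᶻ c is) → ∃ λ o → R c o
  inner-witness {c} (cons {i = i} {os} _ _ r rest) p with T-∨⁻ {c ==ᶻ i} p
  ... | inj₁ c≡i = headOr os , subst (λ x → R x (headOr os)) (sym (==ᶻ⇒≡ c≡i)) r
  ... | inj₂ q   = inner-witness rest q

  outer-witness : ∀ {P : ℤ → Set} {c os is} → (∀ {i o} → R i o → P o) →
                  Interlacing R os is → P (headOr os) → T (elemᶻ c os) → P c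
  outer-witness {P} {c} _ (single o) po p with T-∨⁻ {c ==ᶻ o} p
  ... | inj₁ c≡o = subst P (sym (==ᶻ⇒≡ c≡o)) po
  outer-witness {P} {c} R⇒P (cons {o} _ _ r rest) po p with T-∨⁻ {c ==ᶻ o} p
  ... | inj₁ c≡o = subst P (sym (==ᶻ⇒≡ c≡o)) po
  ... | inj₂ q   = outer-witness R⇒P rest (R⇒P r) q

-- Corner contents of a partition

filter-applyUpTo-none : ∀ {A : Set} (q : A → Bool) f n →
  (∀ {j} → j ℕ.< n → ¬ T (q (f j))) → filterᵇ q (applyUpTo f n) ≡ []
filter-applyUpTo-none q f n none = LP.filter-none (T? ∘ q) (applyUpTo⁺₁ f n none)

filter-applyUpTo-unique : ∀ {A : Set} (q : A → Bool) f n p → p ℕ.< n → T (q (f p)) →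
  (∀ {j} → j ℕ.< n → T (q (f j)) → j ≡ p) → filterᵇ q (applyUpTo f n) ≡ f p ∷ []
filter-applyUpTo-unique q f (suc n) zero _ t only =
  trans (LP.filter-accept (T? ∘ q) t)
        (cong (f 0 ∷_) (filter-applyUpTo-none q (f ∘ suc) n (λ j<n t′ → case only (s≤s j<n) t′ of λ ())))
filter-applyUpTo-unique q f (suc n) (suc p) (s≤s p<n) t only =
  trans (LP.filter-reject (T? ∘ q) (λ t₀ → case only (s≤s z≤n) t₀ of λ ()))
        (filter-applyUpTo-unique q (f ∘ suc) n p p<n t (λ j<n t′ → ℕP.suc-injective (only (s≤s j<n) t′)))

module CornerRows (ps : List ℕ) where

  cellAt : ℕ → ℕ → Cell
  cellAt k j = (+ suc k , + suc j)

  suc-+1 : ∀ n → n ℕ.+ 1 ≡ suc n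
  suc-+1 n = ℕP.+-comm n 1

  nth-+1 : ∀ k → nth ps (k ℕ.+ 1) ≡ nth ps (suc k)
  nth-+1 k = cong (nth ps) (suc-+1 k)

  ≤ᵇ⇒≤ : ∀ {m n} → T (m ℕ.≤ᵇ n) → m ℕ.≤ n
  ≤ᵇ⇒≤ = ℕP.≤ᵇ⇒≤ _ _

  isOuter-cellAt⇒ : ∀ k j → T (isOuter ps (cellAt k j)) → suc j ≡ nth ps k × nth ps (suc k) ℕ.< suc j
  isOuter-cellAt⇒ k j t = ℕP.≤-antisym (≤ᵇ⇒≤ in-row) (ℕP.≤-pred (ℕP.≰⇒> east-out)) , ℕP.≰⇒> south-out
    where
    in-row = T-∧⁻ˡ {inλ ps (cellAt k j)} t
    rest   = T-∧⁻ʳ {inλ ps (cellAt k j)} t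
    east-out : ¬ (suc (suc j) ℕ.≤ nth ps k)
    east-out le = T-not⁻ (T-∧⁻ˡ {not (inλ ps (eC (cellAt k j)))} rest) (ℕP.≤⇒≤ᵇ (subst (ℕ._≤ nth ps k) (sym (suc-+1 (suc j))) le))
    south-out : ¬ (suc j ℕ.≤ nth ps (suc k))
    south-out le = T-not⁻ (T-∧⁻ʳ {not (inλ ps (eC (cellAt k j)))} rest) (ℕP.≤⇒≤ᵇ (subst (suc j ℕ.≤_) (sym (nth-+1 k)) le))

  isOuter-cellAt⁺ : ∀ k j → suc j ≡ nth ps k → nth ps (suc k) ℕ.< suc j → T (isOuter ps (cellAt k j))
  isOuter-cellAt⁺ k j e lt = T-∧⁺ {inλ ps (cellAt k j)} (ℕP.≤⇒≤ᵇ (ℕP.≤-reflexive e))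
    (T-∧⁺ {not (inλ ps (eC (cellAt k j)))}
      (T-not⁺ (λ t → ℕP.<-irrefl e (subst (ℕ._≤ nth ps k) (suc-+1 (suc j)) (≤ᵇ⇒≤ t))))
      (T-not⁺ (λ t → ℕP.<-irrefl refl (ℕP.<-≤-trans lt (subst (suc j ℕ.≤_) (nth-+1 k) (≤ᵇ⇒≤ t))))))

  isInner-cellAt⇒ : ∀ k j → T (isInner ps (cellAt k j)) → suc j ≡ nth ps (suc k) × suc j ℕ.< nth ps k
  isInner-cellAt⇒ k j t =
    ℕP.≤-antisym south-in (ℕP.≤-pred (ℕP.≰⇒> south-east-out)) ,
    subst (ℕ._≤ nth ps k) (suc-+1 (suc j)) (≤ᵇ⇒≤ (T-∧⁻ˡ {inλ ps (eC (cellAt k j))} t))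
    where
    rest = T-∧⁻ʳ {inλ ps (eC (cellAt k j))} t
    south-in : suc j ℕ.≤ nth ps (suc k)
    south-in = subst (suc j ℕ.≤_) (nth-+1 k) (≤ᵇ⇒≤ (T-∧⁻ˡ {inλ ps (sC (cellAt k j))} rest))
    south-east-out : ¬ (suc (suc j) ℕ.≤ nth ps (suc k))
    south-east-out le = T-not⁻ (T-∧⁻ʳ {inλ ps (sC (cellAt k j))} rest)
      (ℕP.≤⇒≤ᵇ (subst₂ ℕ._≤_ (sym (suc-+1 (suc j))) (sym (nth-+1 k)) le))

  isInner-cellAt⁺ : ∀ k j → suc j ≡ nth ps (suc k) → suc j ℕ.< nth ps k → T (isInner ps (cellAt k j))
  isInner-cellAt⁺ k j e lt =
    T-∧⁺ {inλ ps (eC (cellAt k j))} (ℕP.≤⇒≤ᵇ (subst (ℕ._≤ nth ps k) (sym (suc-+1 (suc j))) lt))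
      (T-∧⁺ {inλ ps (sC (cellAt k j))} (ℕP.≤⇒≤ᵇ (ℕP.≤-reflexive (trans e (sym (nth-+1 k)))))
        (T-not⁺ (λ t → ℕP.<-irrefl (trans e (sym (nth-+1 k)))
                         (subst (ℕ._≤ nth ps (k ℕ.+ 1)) (suc-+1 (suc j)) (≤ᵇ⇒≤ t)))))

  outerRow innerRow : ℕ → ℕ → ℕ → List ℤ
  outerRow k m m′ = if m′ ℕ.<ᵇ m then (+ m - + suc k) ∷ [] else []
  innerRow k m m′ = if (0 ℕ.<ᵇ m′) ∧ (m′ ℕ.<ᵇ m) then (+ m′ - + suc k) ∷ [] else []

  rowOuterContents : ∀ k m → nth ps k ≡ m →
    map content (filterᵇ (isOuter ps) (applyUpTo (cellAt k) m)) ≡ outerRow k m (nth ps (suc k))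
  rowOuterContents k m e with nth ps (suc k) ℕ.<ᵇ m in lt
  rowOuterContents k zero e | true = case ℕP.<ᵇ⇒< (nth ps (suc k)) 0 (Equivalence.from T-≡ lt) of λ ()
  rowOuterContents k (suc m₀) e | true =
    cong (map content) (filter-applyUpTo-unique (isOuter ps) (cellAt k) (suc m₀) m₀ ℕP.≤-refl
      (isOuter-cellAt⁺ k m₀ (sym e) (ℕP.<ᵇ⇒< _ _ (Equivalence.from T-≡ lt)))
      (λ _ t → ℕP.suc-injective (trans (proj₁ (isOuter-cellAt⇒ k _ t)) e)))
  ... | false = cong (map content) (filter-applyUpTo-none (isOuter ps) (cellAt k) m λ {j} _ t →
    let (on-edge , below) = isOuter-cellAt⇒ k j t in
    subst T lt (ℕP.<⇒<ᵇ (subst (nth ps (suc k) ℕ.<_) (trans on-edge e) below)))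

  rowInnerContents : ∀ k m → nth ps k ≡ m →
    map content (filterᵇ (isInner ps) (applyUpTo (cellAt k) m)) ≡ innerRow k m (nth ps (suc k))
  rowInnerContents k m e with nth ps (suc k) in e′
  ... | zero = cong (map content) (filter-applyUpTo-none (isInner ps) (cellAt k) m λ _ t →
    case trans (proj₁ (isInner-cellAt⇒ k _ t)) e′ of λ ())
  ... | suc p with suc p ℕ.<ᵇ m in lt
  ...   | true = cong (map content) (filter-applyUpTo-unique (isInner ps) (cellAt k) m p p<m
      (isInner-cellAt⁺ k p (sym e′) (subst (suc p ℕ.<_) (sym e) 1+p<m))
      (λ _ t → ℕP.suc-injective (trans (proj₁ (isInner-cellAt⇒ k _ t)) e′)))
    where
    1+p<m = ℕP.<ᵇ⇒< _ _ (Equivalence.from T-≡ lt)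
    p<m   = ℕP.<-trans (ℕP.n<1+n p) 1+p<m
  ...   | false = cong (map content) (filter-applyUpTo-none (isInner ps) (cellAt k) m λ {j} _ t →
    let (on-edge , inside) = isInner-cellAt⇒ k j t in
    subst T lt (ℕP.<⇒<ᵇ (subst₂ ℕ._<_ (trans on-edge e′) e inside)))

  SuffixAt : ℕ → List ℕ → Set
  SuffixAt k ms = ∀ t → nth ps (k ℕ.+ t) ≡ nth ms t

  byRows : (ℕ → ℕ → ℕ → List ℤ) → ℕ → List ℕ → List ℤ
  byRows row k []       = []
  byRows row k (m ∷ ms) = row k m (nth ms 0) ++ byRows row (suc k) ms

  suffixAt-head : ∀ {k m ms} → SuffixAt k (m ∷ ms) → nth ps k ≡ m
  suffixAt-head {k} suf = trans (cong (nth ps) (sym (ℕP.+-identityʳ k))) (suf 0)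

  suffixAt-next : ∀ {k m ms} → SuffixAt k (m ∷ ms) → nth ps (suc k) ≡ nth ms 0
  suffixAt-next {k} suf = trans (sym (nth-+1 k)) (suf 1)

  suffixAt-tail : ∀ {k m ms} → SuffixAt k (m ∷ ms) → SuffixAt (suc k) ms
  suffixAt-tail {k} suf t = trans (cong (nth ps) (sym (ℕP.+-suc k t))) (suf (suc t))

  contents-byRows : ∀ (q : Cell → Bool) row →
    (∀ k m → nth ps k ≡ m → map content (filterᵇ q (applyUpTo (cellAt k) m)) ≡ row k m (nth ps (suc k))) →
    ∀ k ms → SuffixAt k ms → map content (filterᵇ q (cellsFrom k ms)) ≡ byRows row k ms
  contents-byRows q row rowEq k []       _   = refl
  contents-byRows q row rowEq k (m ∷ ms) suf = begin
    map content (filterᵇ q (map (cellAt k) (upTo m) ++ cellsFrom (suc k) ms))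
      ≡⟨ cong (map content) (LP.filter-++ (T? ∘ q) (map (cellAt k) (upTo m)) _) ⟩
    map content (filterᵇ q (map (cellAt k) (upTo m)) ++ filterᵇ q (cellsFrom (suc k) ms))
      ≡⟨ LP.map-++ content (filterᵇ q (map (cellAt k) (upTo m))) _ ⟩
    map content (filterᵇ q (map (cellAt k) (upTo m))) ++ map content (filterᵇ q (cellsFrom (suc k) ms))
      ≡⟨ cong₂ _++_ thisRow (contents-byRows q row rowEq (suc k) ms (suffixAt-tail suf)) ⟩
    row k m (nth ms 0) ++ byRows row (suc k) ms ∎
    where
    open ≡-Reasoning
    thisRow : map content (filterᵇ q (map (cellAt k) (upTo m))) ≡ row k m (nth ms 0)
    thisRow = trans (cong (map content ∘ filterᵇ q) (LP.map-upTo (cellAt k) m))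
                    (trans (rowEq k m (suffixAt-head suf)) (cong (row k m) (suffixAt-next suf)))

  outerAt innerAt : ℕ → ℤ
  outerAt k = + nth ps k - + suc k
  innerAt k = + nth ps (suc k) - + suc k

  Descent : ℕ → Set
  Descent k = nth ps (suc k) ℕ.< nth ps k

  RowPair : ℤ → ℤ → Set
  RowPair i o = ∃ λ k → Descent k × i ≡ innerAt k × o ≡ outerAt k

  LastRow : ℤ → Set
  LastRow o = ∃ λ k → nth ps (suc k) ≡ 0 × Descent k × o ≡ outerAt k

  descInterlacing : ∀ k m ms → SuffixAt k (m ∷ ms) → All (0 ℕ.<_) (m ∷ ms) → Linked ℕ._≥_ (m ∷ ms) →
    DescInterlacing RowPair LastRow (byRows outerRow k (m ∷ ms)) (byRows innerRow k (m ∷ ms)) ×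
    headOr (byRows outerRow k (m ∷ ms)) ≤ + m - + suc k
  descInterlacing k (suc m) [] suf (s≤s z≤n ∷ []) _ =
    single (k , next≡0 , subst₂ ℕ._<_ (sym next≡0) (sym this) (s≤s z≤n) , cong (λ x → + x - + suc k) (sym this)) ,
    ℤP.≤-refl
    where
    this = suffixAt-head suf
    next≡0 = suffixAt-next suf
  descInterlacing k m (m′ ∷ ms) suf (0<m ∷ 0<m′@(s≤s z≤n) ∷ positive) (m≥m′ ∷ dec)
    with descInterlacing (suc k) m′ ms (suffixAt-tail suf) (0<m′ ∷ positive) dec | m′ ℕ.<ᵇ m in lt
  ... | rest , bound | true =
    cons (ℤP.+-monoˡ-< (- + suc k) (+<+ m′<m)) (ℤP.≤-<-trans bound (sub-mono-≤-< (ℤP.≤-refl {+ m′}) (+<+ (ℕP.n<1+n (suc k)))))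
         (k , subst₂ ℕ._<_ (sym next) (sym this) m′<m , cong (λ x → + x - + suc k) (sym next) ,
              cong (λ x → + x - + suc k) (sym this))
         rest ,
    ℤP.≤-refl
    where
    this = suffixAt-head suf
    next = suffixAt-next suf
    m′<m = ℕP.<ᵇ⇒< m′ m (Equivalence.from T-≡ lt)
  ... | rest , bound | false =
    rest , ℤP.≤-trans bound (sub-mono-≤ (+≤+ m≥m′) (+≤+ (ℕP.n≤1+n (suc k))))

module Corners (m : ℕ) (ms : List ℕ) (positive : All (0 ℕ.<_) (m ∷ ms)) (dec : Linked ℕ._≥_ (m ∷ ms)) where

  private
    ps : List ℕ
    ps = m ∷ ms

  open Diagram ps dec
  open CornerRows ps

  OS IS : List ℤ
  OS = reverse (byRows outerRow 0 ps)
  IS = reverse (byRows innerRow 0 ps)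

  private
    desc = proj₁ (descInterlacing 0 m ms (λ _ → refl) positive dec)

  interlacing : Interlacing RowPair OS IS
  interlacing = reverse-interlacing desc

  lastRow-headOr : LastRow (headOr OS)
  lastRow-headOr = subst LastRow (sym (headOr-reverse (byRows outerRow 0 ps))) (descInterlacing-last desc)

  outerContents≡OS : outerContents ps ≡ OS
  outerContents≡OS = trans (cong sort (contents-byRows (isOuter ps) outerRow rowOuterContents 0 ps (λ _ → refl)))
                         (sort-unique _ OS (Interlacing-outer↗ interlacing) (↭-reverse _))

  innerContents≡IS : innerContents ps ≡ IS
  innerContents≡IS = trans (cong sort (contents-byRows (isInner ps) innerRow rowInnerContents 0 ps (λ _ → refl)))
                         (sort-unique _ IS (Interlacing-inner↗ interlacing) (↭-reverse _))

  innerAt<outerAt : ∀ {k} → Descent k → innerAt k < outerAt k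
  innerAt<outerAt {k} d = ℤP.+-monoˡ-< (- + suc k) (+<+ d)

  eC-∈λ-inRow : ∀ w k → InΛ ps w → innerAt k ≤ content w → content w < outerAt k → InΛ ps (eC w)
  eC-∈λ-inRow w@(a , b) k w∈ lo hi with a ℤ.≤? + suc k
  ... | yes a≤s = ∈λ⁺ (eC w) (≤⇒≤+1 (∈λ⇒1≤col w w∈))
        (ℤP.≤-trans (<⇒+1≤ b<λₖ) (+≤+ (rowLen-antitone (∈λ⇒1≤row w w∈) a≤s)))
    where
    b<λₖ : b < + nth ps k
    b<λₖ = ℤP.≰⇒> (λ λₖ≤b → ℤP.<⇒≱ hi (content-mono-≤ a≤s λₖ≤b))
  ... | no a≰s = ⊥-elim (ℤP.<⇒≱ (content-mono-<₁ s<a b≤λₖ₊₁) lo)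
    where
    s<a : + suc k < a
    s<a = ℤP.≰⇒> a≰s
    b≤λₖ₊₁ : b ≤ + nth ps (suc k)
    b≤λₖ₊₁ = ℤP.≤-trans (∈λ⇒col≤rowLen w w∈)
                        (+≤+ (rowLen-antitone (+≤+ (s≤s z≤n)) (ℤP.i<j⇒suc[i]≤j s<a)))

  columnBottom-ofContent : ∀ k {c} → innerAt k < c → c ≤ outerAt k →
                           ∃ λ r → ColumnBottom ps r × content r ≡ c
  columnBottom-ofContent k {c} lo hi =
    r , columnBottom (∈λ⁺ r 1≤col (≤-⇒+≤ hi)) s∉ , cancel c (+ suc k)
    where
    r = (+ suc k , c + + suc k)
    λₖ₊₁<col : + nth ps (suc k) < c + + suc k
    λₖ₊₁<col = -<⇒<+ lo
    1≤col : + 1 ≤ c + + suc k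
    1≤col = ℤP.i<j⇒suc[i]≤j (ℤP.≤-<-trans (+≤+ z≤n) λₖ₊₁<col)
    s∉ : ¬ InΛ ps (sC r)
    s∉ p = ℤP.<⇒≱ λₖ₊₁<col (subst (λ n → c + + suc k ≤ + n) (nth-+1 k) (∈λ⇒col≤rowLen (sC r) p))
    cancel : ∀ c s → c + s - s ≡ c
    cancel = solve-∀

  lastRow-innerAt< : ∀ k w → nth ps (suc k) ≡ 0 → InΛ ps w → innerAt k < content w
  lastRow-innerAt< k w@(a , b) λₖ₊₁≡0 w∈ =
    subst (λ n → + n - + suc k < b - a) (sym λₖ₊₁≡0) (content-mono-<₂ a≤s (ℤP.suc[i]≤j⇒i<j {+ 0} 1≤b))
    where
    1≤b = ∈λ⇒1≤col w w∈
    a≤s : a ≤ + suc k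
    a≤s = ℤP.≮⇒≥ λ s<a → case ℤP.≤-trans 1≤b (ℤP.≤-trans (∈λ⇒col≤rowLen w w∈)
            (+≤+ (subst (rowLen ps a ℕ.≤_) λₖ₊₁≡0
               (rowLen-antitone (+≤+ (s≤s z≤n)) (ℤP.i<j⇒suc[i]≤j s<a))))) of λ { (+≤+ ()) }

  atOuterᵇ atInnerᵇ : ℤ → List ℤ → List ℤ → Bool
  atOuterᵇ c os _ = elemᶻ c os
  atInnerᵇ c _ is = elemᶻ c is

  inCorners⇒ : ∀ (f : ℤ → List ℤ → List ℤ → Bool) w →
               T (inλ ps w ∧ f (content w) (outerContents ps) (innerContents ps)) → InΛ ps w × T (f (content w) OS IS)
  inCorners⇒ f w t = T-∧⁻ˡ {inλ ps w} t ,
    subst₂ (λ os is → T (f (content w) os is)) outerContents≡OS innerContents≡IS (T-∧⁻ʳ {inλ ps w} t)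

  inCorners⁺ : ∀ (f : ℤ → List ℤ → List ℤ → Bool) w →
               InΛ ps w → T (f (content w) OS IS) → T (inλ ps w ∧ f (content w) (outerContents ps) (innerContents ps))
  inCorners⁺ f w w∈ t = T-∧⁺ {inλ ps w} w∈
    (subst₂ (λ os is → T (f (content w) os is)) (sym outerContents≡OS) (sym innerContents≡IS) t)

  A-rowWitness : ∀ w → T (inA ps w) → ∃ λ k → innerAt k < content w × content w < outerAt k
  A-rowWitness w a with inCorners⇒ aRegion w a
  ... | w∈ , a′ with A-content-witness interlacing a′ | lastRow-headOr
  ...   | inj₁ below | k , λₖ₊₁≡0 , _ , o≡ = k , lastRow-innerAt< k w λₖ₊₁≡0 w∈ , subst (content w <_) o≡ below
  ...   | inj₂ (_ , _ , (k , _ , i≡ , o≡) , lo , hi) | _ = k , subst (_< content w) i≡ lo , subst (content w <_) o≡ hi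

  cell-IA⊎OB : ∀ w → InΛ ps w → T (inI ps w ∨ inA ps w) ⊎ T (inO ps w ∨ inB ps w)
  cell-IA⊎OB w w∈ with region-cover interlacing (content w)
  ... | regionA p = inj₁ (T-∨⁺ʳ {inI ps w} (inCorners⁺ aRegion w w∈ p))
  ... | regionB p = inj₂ (T-∨⁺ʳ {inO ps w} (inCorners⁺ bRegion w w∈ p))
  ... | atOuter p = inj₂ (T-∨⁺ˡ (inCorners⁺ atOuterᵇ w w∈ p))
  ... | atInner p = inj₁ (T-∨⁺ˡ (inCorners⁺ atInnerᵇ w w∈ p))

  OB⇒next-BI : ∀ w x → T (inO ps w ∨ inB ps w) → InΛ ps x → content x ≡ content w + + 1 → T (inB ps x ∨ inI ps x)
  OB⇒next-BI w x t x∈ e with OB-content-suc interlacing OB-content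
    where
    OB-content : T (elemᶻ (content w) OS) ⊎ T (bRegion (content w) OS IS)
    OB-content with T-∨⁻ {inO ps w} t
    ... | inj₁ o = inj₁ (proj₂ (inCorners⇒ atOuterᵇ w o))
    ... | inj₂ b = inj₂ (proj₂ (inCorners⇒ bRegion w b))
  ... | inj₁ b = T-∨⁺ˡ (inCorners⁺ bRegion x x∈ (subst (λ c → T (bRegion c OS IS)) (sym e) b))
  ... | inj₂ i = T-∨⁺ʳ {inB ps x} (inCorners⁺ atInnerᵇ x x∈ (subst (λ c → T (elemᶻ c IS)) (sym e) i))

  IA⇒eC-∈λ : ∀ w → InΛ ps w → T (inI ps w ∨ inA ps w) → InΛ ps (eC w)
  IA⇒eC-∈λ w w∈ t with T-∨⁻ {inI ps w} t
  ... | inj₂ a with A-rowWitness w a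
  ...   | k , lo , hi = eC-∈λ-inRow w k w∈ (ℤP.<⇒≤ lo) hi
  IA⇒eC-∈λ w w∈ t | inj₁ i with inner-witness interlacing (proj₂ (inCorners⇒ atInnerᵇ w i))
  ...   | _ , k , d , c≡ , _ =
    eC-∈λ-inRow w k w∈ (ℤP.≤-reflexive (sym c≡)) (subst (_< outerAt k) (sym c≡) (innerAt<outerAt d))

  OuterAt : ℤ → Set
  OuterAt c = ∃ λ k → Descent k × c ≡ outerAt k

  OA⇒columnBottom : ∀ w → T (inO ps w ∨ inA ps w) → ∃ λ r → ColumnBottom ps r × content r ≡ content w
  OA⇒columnBottom w t with T-∨⁻ {inO ps w} t
  ... | inj₂ a with A-rowWitness w a
  ...   | k , lo , hi = columnBottom-ofContent k lo (ℤP.<⇒≤ hi)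
  OA⇒columnBottom w t | inj₁ o
    with outer-witness {P = OuterAt} (λ (k , d , _ , o≡) → k , d , o≡) interlacing
           (let (k , _ , d , o≡) = lastRow-headOr in k , d , o≡) (proj₂ (inCorners⇒ atOuterᵇ w o))
  ...   | k , d , c≡ =
    columnBottom-ofContent k (subst (innerAt k <_) (sym c≡) (innerAt<outerAt d)) (ℤP.≤-reflexive c≡)

¬∈λ[] : ∀ w → ¬ InΛ [] w
¬∈λ[] w@(i , _) w∈ with ℤP.≤-trans (∈λ⇒1≤col w w∈) (subst (λ n → col w ≤ + n) (rowLen-[] i) (∈λ⇒col≤rowLen w w∈))
  where
  open Diagram [] []
  rowLen-[] : ∀ i → rowLen [] i ≡ 0
  rowLen-[] (+ zero)   = refl
  rowLen-[] (+ suc _)  = refl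
  rowLen-[] -[1+ _ ]   = refl
... | +≤+ ()

cell-IA⊎OB : ∀ {ps} → All (0 ℕ.<_) ps → Linked ℕ._≥_ ps →
  ∀ w → InΛ ps w → T (inI ps w ∨ inA ps w) ⊎ T (inO ps w ∨ inB ps w)
cell-IA⊎OB {[]}     _ _ w w∈ = ⊥-elim (¬∈λ[] w w∈)
cell-IA⊎OB {m ∷ ms} positive dec = Corners.cell-IA⊎OB m ms positive dec

OB⇒next-BI : ∀ {ps} → All (0 ℕ.<_) ps → Linked ℕ._≥_ ps →
  ∀ w x → T (inO ps w ∨ inB ps w) → InΛ ps x → content x ≡ content w + + 1 → T (inB ps x ∨ inI ps x)
OB⇒next-BI {[]}     _ _ _ x _ x∈ = ⊥-elim (¬∈λ[] x x∈)
OB⇒next-BI {m ∷ ms} positive dec = Corners.OB⇒next-BI m ms positive dec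

IA⇒eC-∈λ : ∀ {ps} → All (0 ℕ.<_) ps → Linked ℕ._≥_ ps →
  ∀ w → InΛ ps w → T (inI ps w ∨ inA ps w) → InΛ ps (eC w)
IA⇒eC-∈λ {[]}     _ _ w w∈ = ⊥-elim (¬∈λ[] w w∈)
IA⇒eC-∈λ {m ∷ ms} positive dec = Corners.IA⇒eC-∈λ m ms positive dec

OA⇒columnBottom : ∀ {ps} → All (0 ℕ.<_) ps → Linked ℕ._≥_ ps →
  ∀ w → InΛ ps w → T (inO ps w ∨ inA ps w) → ∃ λ r → ColumnBottom ps r × content r ≡ content w
OA⇒columnBottom {[]}     _ _ w w∈ = ⊥-elim (¬∈λ[] w w∈)
OA⇒columnBottom {m ∷ ms} positive dec w _ = Corners.OA⇒columnBottom m ms positive dec w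

-- The paths Q and P

decide : Bool → Bool → Bool → QAction
decide a b c = if a then north else (if b then east else (if c then stop else stuck))

decide≡north : ∀ a b c → decide a b c ≡ north → T a
decide≡north true  _     _     _ = tt
decide≡north false true  _     ()
decide≡north false false true  ()
decide≡north false false false ()

decide≡east : ∀ a b c → decide a b c ≡ east → T b
decide≡east false true  _     _ = tt
decide≡east true  _     _     ()
decide≡east false false true  ()
decide≡east false false false ()

decide≡stop : ∀ a b c → decide a b c ≡ stop → T c
decide≡stop false false true  _ = tt
decide≡stop true  _     _     ()
decide≡stop false true  _     ()
decide≡stop false false false ()

decide≡stuck : ∀ a b c → decide a b c ≡ stuck → ¬ T a × ¬ T b × ¬ T c
decide≡stuck false false false _ = (λ ()) , (λ ()) , (λ ())
decide≡stuck true  _     _     ()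
decide≡stuck false true  _     ()
decide≡stuck false false true  ()

module Paths (ps : List ℕ) (positive : All (0 ℕ.<_) ps) (dec : Linked ℕ._≥_ ps)
             (π : Cell → ℕ) (rpp : IsRPP ps π) where

  open Diagram ps dec

  val : Cell → Val
  val = ext ps π

  Positive : Cell → Set
  Positive w = T (fin 0 <ᵛ val w)

  val-row≤0 : ∀ w → row w ≤ + 0 → val w ≡ fin 0
  val-row≤0 (i , j) p rewrite Equivalence.to T-≡ (ℤP.≤⇒≤ᵇ p) = refl

  val-nC≤ : ∀ w → InΛ ps w → T (val (nC w) ≤ᵛ val w)
  val-nC≤ w w∈ with row w - + 1 ℤ.≤? + 0
  ... | yes top = subst (λ v → T (v ≤ᵛ val w)) (sym (val-row≤0 (nC w) top)) (0≤ᵛ (val w))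
  ... | no ¬top = subst (λ v → T (val (nC w) ≤ᵛ val v)) (sC∘nC w)
                        (proj₂ (rpp (nC w) (nC-∈λ w w∈ (ℤP.i<j⇒suc[i]≤j (ℤP.≰⇒> ¬top)))))

  cand⇒ : ∀ u → Cand ps π u → InΛ ps u × T (inO ps u ∨ inA ps u) × Positive u
  cand⇒ u c with T-∨⁻ {inO ps u ∧ (val (wC u) <ᵛ val u)} c
  ... | inj₁ p = T-∧⁻ˡ {inλ ps u} (T-∧⁻ˡ {inO ps u} p) , T-∨⁺ˡ (T-∧⁻ˡ {inO ps u} p) ,
                 ≤ᵛ-<ᵛ-trans (fin 0) (val (wC u)) (val u) (0≤ᵛ (val (wC u))) (T-∧⁻ʳ {inO ps u} p)
  ... | inj₂ p = T-∧⁻ˡ {inλ ps u} (T-∧⁻ˡ {inA ps u} p) , T-∨⁺ʳ {inO ps u} (T-∧⁻ˡ {inA ps u} p) ,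
                 ≤ᵛ-<ᵛ-trans (fin 0) (val (wC u)) (val u) (0≤ᵛ (val (wC u)))
                   (T-∧⁻ˡ {val (wC u) <ᵛ val u} (T-∧⁻ʳ {inA ps u} p))

  -- qStep ps π w is decide (northCond w) (eastCond w) (stopCond w) by definition.
  northCond eastCond stopCond : Cell → Bool
  northCond w = (inO ps w ∨ inB ps w) ∧ (val w ==ᵛ val (nC w))
  eastCond  w = (inI ps w ∨ inA ps w) ∨ (inλ ps (eC w) ∧ (val (nC w) <ᵛ val w))
  stopCond  w = (val (nC w) <ᵛ val w) ∧ not (inλ ps (eC w))

  north-step : ∀ w → InΛ ps w → Positive w → qStep ps π w ≡ north → InΛ ps (nC w) × Positive (nC w)
  north-step w w∈ w>0 eq = n∈ , n>0
    where
    n>0 : Positive (nC w)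
    n>0 = <ᵛ-≤ᵛ-trans (fin 0) (val w) (val (nC w)) w>0 (T-∧⁻ˡ {val w ≤ᵛ val (nC w)}
            (T-∧⁻ʳ {inO ps w ∨ inB ps w} (decide≡north (northCond w) (eastCond w) (stopCond w) eq)))
    n∈ : InΛ ps (nC w)
    n∈ with row w - + 1 ℤ.≤? + 0
    ... | yes top = ⊥-elim (T-not⁻ (subst (λ v → T (fin 0 <ᵛ v)) (val-row≤0 (nC w) top) n>0) tt)
    ... | no ¬top = nC-∈λ w w∈ (ℤP.i<j⇒suc[i]≤j (ℤP.≰⇒> ¬top))

  east-step : ∀ w → InΛ ps w → Positive w → qStep ps π w ≡ east → InΛ ps (eC w) × Positive (eC w)
  east-step w w∈ w>0 eq = e∈ , <ᵛ-≤ᵛ-trans (fin 0) (val w) (val (eC w)) w>0 (proj₁ (rpp w w∈))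
    where
    e∈ : InΛ ps (eC w)
    e∈ with T-∨⁻ {inI ps w ∨ inA ps w} (decide≡east (northCond w) (eastCond w) (stopCond w) eq)
    ... | inj₁ ia = IA⇒eC-∈λ positive dec w w∈ ia
    ... | inj₂ c  = T-∧⁻ˡ {inλ ps (eC w)} c

  stop⇒eC-∉λ : ∀ w → qStep ps π w ≡ stop → ¬ InΛ ps (eC w)
  stop⇒eC-∉λ w eq = T-not⁻ (T-∧⁻ʳ {val (nC w) <ᵛ val w} (decide≡stop (northCond w) (eastCond w) (stopCond w) eq))

  north< : ∀ {w} → InΛ ps w → ¬ T (northCond w) → T (inO ps w ∨ inB ps w) → T (val (nC w) <ᵛ val w)
  north< {w} w∈ ¬N ob = T-not⁺ λ le →
    ¬N (T-∧⁺ {inO ps w ∨ inB ps w} ob (T-∧⁺ {val w ≤ᵛ val (nC w)} le (val-nC≤ w w∈)))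

  qStep≢stuck : ∀ w → InΛ ps w → qStep ps π w ≢ stuck
  qStep≢stuck w w∈ eq with decide≡stuck (northCond w) (eastCond w) (stopCond w) eq | cell-IA⊎OB positive dec w w∈
  ... | _ , ¬E , _ | inj₁ ia = ¬E (T-∨⁺ˡ ia)
  ... | ¬N , ¬E , ¬S | inj₂ ob with inλ ps (eC w) in e∈?
  ...   | true  = ¬E (T-∨⁺ʳ {inI ps w ∨ inA ps w} (north< {w} w∈ ¬N ob))
  ...   | false = ¬S (T-∧⁺ {val (nC w) <ᵛ val w} (north< {w} w∈ ¬N ob) tt)

  λ₁ : ℤ
  λ₁ = + L (+ 1)

  content<λ₁ : ∀ w → InΛ ps w → content w < λ₁
  content<λ₁ w w∈ = subst (content w <_) (ℤP.+-identityʳ λ₁)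
    (content-mono-<₁ (ℤP.suc[i]≤j⇒i<j {+ 0} (∈λ⇒1≤row w w∈))
      (ℤP.≤-trans (∈λ⇒col≤rowLen w w∈) (+≤+ (rowLen-antitone ℤP.≤-refl (∈λ⇒1≤row w w∈)))))

  qRun-fuel : ∀ n w → InΛ ps w → Positive w → λ₁ ≤ content w + + n → Σ (List Cell) (QRun ps π w)
  qRun-fuel zero w w∈ _ bound =
    ⊥-elim (ℤP.<⇒≱ (content<λ₁ w w∈) (subst (λ₁ ≤_) (ℤP.+-identityʳ (content w)) bound))
  qRun-fuel (suc n) w w∈ w>0 bound with qStep ps π w in eq
  ... | north = let (n∈ , n>0) = north-step w w∈ w>0 eq
                    (rest , run) = qRun-fuel n (nC w) n∈ n>0 (subst (λ c → λ₁ ≤ c + + n) (sym (content-nC w)) bound′)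
                in nC w ∷ rest , qnorth eq run
    where bound′ = subst (λ₁ ≤_) (+suc≡+1+ (content w) n) bound
  ... | east  = let (e∈ , e>0) = east-step w w∈ w>0 eq
                    (rest , run) = qRun-fuel n (eC w) e∈ e>0 (subst (λ c → λ₁ ≤ c + + n) (sym (content-eC w)) bound′)
                in eC w ∷ rest , qeast eq run
    where bound′ = subst (λ₁ ≤_) (+suc≡+1+ (content w) n) bound
  ... | stop  = [] , qstop eq
  ... | stuck = ⊥-elim (qStep≢stuck w w∈ eq)

  qRun-exists : ∀ w → InΛ ps w → Positive w → Σ (List Cell) (QRun ps π w)
  qRun-exists w w∈ w>0 = qRun-fuel ∣ λ₁ - content w ∣ w w∈ w>0
    (subst (_≤ content w + + ∣ λ₁ - content w ∣) (cancel λ₁ (content w)) (ℤP.+-monoʳ-≤ (content w) (i≤+∣i∣ _)))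
    where
    cancel : ∀ a c → c + (a - c) ≡ a
    cancel = solve-∀

  qRun-path : ∀ {w rest} → QRun ps π w rest → Linked NEStep (w ∷ rest)
  qRun-path (qstop _)      = [-]
  qRun-path (qnorth _ run) = inj₁ refl ∷ qRun-path run
  qRun-path (qeast _ run)  = inj₂ refl ∷ qRun-path run

  qRun-end : ∀ {w rest} → QRun ps π w rest → InΛ ps w → Positive w →
             InΛ ps (last (w ∷ rest)) × ¬ InΛ ps (eC (last (w ∷ rest)))
  qRun-end {w} (qstop eq) w∈ _ = w∈ , stop⇒eC-∉λ w eq
  qRun-end {w} (qnorth {rest = rest} eq run) w∈ w>0 =
    let (n∈ , n>0) = north-step w w∈ w>0 eq in
    subst (λ z → InΛ ps z × ¬ InΛ ps (eC z)) (sym (last-∷ w (nC w) rest)) (qRun-end run n∈ n>0)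
  qRun-end {w} (qeast {rest = rest} eq run) w∈ w>0 =
    let (e∈ , e>0) = east-step w w∈ w>0 eq in
    subst (λ z → InΛ ps z × ¬ InΛ ps (eC z)) (sym (last-∷ w (eC w) rest)) (qRun-end run e∈ e>0)

  southCond : Cell → Bool
  southCond x = (inB ps x ∨ inI ps x) ∧ (val x ==ᵛ val (sC x))

  pStep-cases : ∀ x → (T (southCond x) × pStep ps π x ≡ sC x) ⊎ (¬ T (southCond x) × pStep ps π x ≡ wC x)
  pStep-cases x with southCond x
  ... | true  = inj₁ (tt , refl)
  ... | false = inj₂ ((λ ()) , refl)

  pStep-content : ∀ x → content (pStep ps π x) ≡ content x - + 1
  pStep-content x with pStep-cases x
  ... | inj₁ (_ , e) = trans (cong content e) (content-sC x)
  ... | inj₂ (_ , e) = trans (cong content e) (content-wC x)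

  pStep-row : ∀ x → row x ≤ row (pStep ps π x)
  pStep-row x with pStep-cases x
  ... | inj₁ (_ , e) = subst (λ y → row x ≤ row y) (sym e) (≤⇒≤+1 ℤP.≤-refl)
  ... | inj₂ (_ , e) = subst (λ y → row x ≤ row y) (sym e) ℤP.≤-refl

  pWalk-suc : ∀ t w → pWalk ps π (suc t) w ≡ pStep ps π (pWalk ps π t w)
  pWalk-suc zero    w = refl
  pWalk-suc (suc t) w = pWalk-suc t (pStep ps π w)

  pWalk-content : ∀ t w → content (pWalk ps π t w) ≡ content w - + t
  pWalk-content zero    w = sym (ℤP.+-identityʳ (content w))
  pWalk-content (suc t) w = begin
    content (pWalk ps π t (pStep ps π w)) ≡⟨ pWalk-content t (pStep ps π w) ⟩
    content (pStep ps π w) - + t          ≡⟨ cong (_- + t) (pStep-content w) ⟩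
    content w - + 1 - + t                 ≡⟨ shift (content w) (+ t) ⟩
    content w - (+ 1 + + t)               ∎
    where
    open ≡-Reasoning
    shift : ∀ c t → c - + 1 - t ≡ c - (+ 1 + t)
    shift = solve-∀

  pWalk-row : ∀ t w → row w ≤ row (pWalk ps π t w)
  pWalk-row zero    w = ℤP.≤-refl
  pWalk-row (suc t) w = ℤP.≤-trans (pStep-row w) (pWalk-row t (pStep ps π w))

  αP-content : ∀ {h} → IsRimHook ps h → content (αP ps π h) ≡ content (α h)
  αP-content {h} hook = begin
    content (αP ps π h)          ≡⟨ pWalk-content (len h) (ω h) ⟩
    content (ω h) - + len h      ≡⟨ cong (_- + len h) (rimHook-content hook) ⟩
    content (α h) + + len h - + len h ≡⟨ cancel (content (α h)) (+ len h) ⟩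
    content (α h)                ∎
    where
    open ≡-Reasoning
    cancel : ∀ a n → a + n - n ≡ a
    cancel = solve-∀

  pStep-content⁻¹ : ∀ x → content (pStep ps π x) + + 1 ≡ content x
  pStep-content⁻¹ x = trans (cong (_+ + 1) (pStep-content x)) (cancel (content x))
    where cancel : ∀ c → c - + 1 + + 1 ≡ c
          cancel = solve-∀

  north-keeps-below : ∀ w x → InΛ ps w → Positive w → qStep ps π w ≡ north →
    content w ≡ content (pStep ps π x) → row (pStep ps π x) < row w →
    content (nC w) ≡ content x × row x < row (nC w)
  north-keeps-below w x w∈ w>0 eq ce lt = content≡ , row<
    where
    content≡ : content (nC w) ≡ content x
    content≡ = trans (content-nC w) (trans (cong (_+ + 1) ce) (pStep-content⁻¹ x))
    goesNorth : T (northCond w)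
    goesNorth = decide≡north (northCond w) (eastCond w) (stopCond w) eq
    -- If P left x = nC w westwards, its rule would have sent it south instead.
    south : T (southCond (nC w))
    south = T-∧⁺ {inB ps (nC w) ∨ inI ps (nC w)}
      (OB⇒next-BI positive dec w (nC w) (T-∧⁻ˡ {inO ps w ∨ inB ps w} goesNorth)
                  (proj₁ (north-step w w∈ w>0 eq)) (content-nC w))
      (subst (λ y → T (val (nC w) ==ᵛ val y)) (sym (sC∘nC w))
             (==ᵛ-sym (val w) (val (nC w)) (T-∧⁻ʳ {inO ps w ∨ inB ps w} goesNorth)))
    row< : row x < row (nC w)
    row< with pStep-cases x
    ... | inj₁ (_ , e) = +1≤⇒< (<⇒≤-1 (subst (λ y → row y < row w) e lt))
    ... | inj₂ (¬south , e) with ℤP.<-cmp (row x) (row (nC w))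
    ...   | tri< x<n _ _ = x<n
    ...   | tri≈ _ x≡n _ = ⊥-elim (¬south (subst (T ∘ southCond) (sym (cell-≡ {x} {nC w} x≡n (sym content≡))) south))
    ...   | tri> _ _ n<x = ⊥-elim (ℤP.<⇒≱ n<x (<⇒≤-1 (subst (λ y → row y < row w) e lt)))

  east-keeps-below : ∀ w x → content w ≡ content (pStep ps π x) → row (pStep ps π x) < row w →
    content (eC w) ≡ content x × row x < row (eC w)
  east-keeps-below w x ce lt =
    trans (content-eC w) (trans (cong (_+ + 1) ce) (pStep-content⁻¹ x)) ,
    ℤP.≤-<-trans (pStep-row x) lt

  -- Q from w against P read backwards from its t-th cell towards its start z.
  Q-below-P : ∀ {z} → RimCell ps z → ∀ {w rest} → QRun ps π w rest → InΛ ps w → Positive w →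
    ∀ t → content w ≡ content (pWalk ps π t z) → row (pWalk ps π t z) < row w →
    row z < row (last (w ∷ rest))
  Q-below-P {z} _ (qstop _) _ _ t _ lt = ℤP.≤-<-trans (pWalk-row t z) lt
  Q-below-P rz {w} (qnorth _ _) w∈ _ zero ce lt =
    ⊥-elim (rim-noCellSouthEast rz w w∈ lt (sameContent-row<⇒col< (sym ce) lt))
  Q-below-P rz {w} (qeast _ _)  w∈ _ zero ce lt =
    ⊥-elim (rim-noCellSouthEast rz w w∈ lt (sameContent-row<⇒col< (sym ce) lt))
  Q-below-P {z} rz {w} (qnorth {rest = rest} eq run) w∈ w>0 (suc t) ce lt
    rewrite pWalk-suc t z | last-∷ w (nC w) rest =
    let (n∈ , n>0) = north-step w w∈ w>0 eq
        (ce′ , lt′) = north-keeps-below w (pWalk ps π t z) w∈ w>0 eq ce lt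
    in Q-below-P rz run n∈ n>0 t ce′ lt′
  Q-below-P {z} rz {w} (qeast {rest = rest} eq run) w∈ w>0 (suc t) ce lt
    rewrite pWalk-suc t z | last-∷ w (eC w) rest =
    let (e∈ , e>0) = east-step w w∈ w>0 eq
        (ce′ , lt′) = east-keeps-below w (pWalk ps π t z) ce lt
    in Q-below-P rz run e∈ e>0 t ce′ lt′

  Q-hook : ∀ u → Cand ps π u →
    Σ (List⁺ Cell) λ h′ → IsHookOfQ ps π u h′ × ColumnBottom ps (α h′) × content (α h′) ≡ content u
  Q-hook u cand with cand⇒ u cand
  ... | u∈ , OA , u>0 with qRun-exists u u∈ u>0 | OA⇒columnBottom positive dec u u∈ OA
  ...   | rest , run | r , r-bottom , r≡u with qRun-end run u∈ u>0
  ...     | z∈ , e∉ with rimHook-fromTo (length rest) r-bottom z∈ e∉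
                          (trans (cong (_+ + length rest) r≡u) (sym (NEPath-content u rest (qRun-path run))))
  ...       | hook , ω≡ , len≡ = r ∷ rimPath (length rest) r , (rest , run , hook , ω≡ , len≡) , r-bottom , r≡u

  hookOfQ<hook : ∀ {h} → IsRimHook ps h → ∀ {u} → Cand ps π u → u ◁ αP ps π h →
    ∀ {h′} → IsHookOfQ ps π u h′ → ColumnBottom ps (α h′) → content (α h′) ≡ content u → h′ <ʰ h
  hookOfQ<hook {h} hook {u} cand u◁ {h′} (rest , run , _ , ω≡ , _) bottom′ c≡ with u◁
  ... | inj₁ cαP<cu , _ = inj₁ col< , λ e → ℤP.<-irrefl (sym (cong col e)) col<
    where
    col< : col (α h) < col (α h′)
    col< = columnBottom-col< bottom′ (α h) (ColumnBottom.∈λ (rimHook-head hook))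
             (subst₂ _<_ (αP-content hook) (sym c≡) cαP<cu)
  ... | inj₂ (ce , αP≤u) , u≢αP = inj₂ (cong col α≡ , ℤP.<⇒≤ row<) , λ e → ℤP.<-irrefl (sym (cong row e)) row<
    where
    u∈ = proj₁ (cand⇒ u cand)
    u>0 = proj₂ (proj₂ (cand⇒ u cand))
    α≡ : α h′ ≡ α h
    α≡ = rim-content-injective (columnBottom⇒rim bottom′) (columnBottom⇒rim (rimHook-head hook))
           (trans c≡ (trans ce (αP-content hook)))
    αP<u : row (αP ps π h) < row u
    αP<u = ℤP.≤∧≢⇒< αP≤u (λ eq → u≢αP (cell-≡ {u} {αP ps π h} (sym eq) ce))
    row< : row (ω h) < row (ω h′)
    row< = subst (λ y → row (ω h) < row y) (sym ω≡) (Q-below-P (rimHook-last hook) run u∈ u>0 (len h) ce αP<u)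

mainTheorem12 : (la : Partition) (π : Cell → ℕ) → IsRPP (Partition.parts la) π →
    (h : List⁺ Cell) → IsRimHook (Partition.parts la) h →
    (u : Cell) → Cand (Partition.parts la) π u →
    u ◁ αP (Partition.parts la) π h →
    Σ (List⁺ Cell) λ h' → IsHookOfQ (Partition.parts la) π u h' × (h' <ʰ h)
mainTheorem12 la π rpp h hook u cand u◁αP =
  let (h′ , isHook , bottom′ , c≡) = Q-hook u cand
  in h′ , isHook , hookOfQ<hook hook cand u◁αP isHook bottom′ c≡
  where open Paths (Partition.parts la) (Partition.positive la) (Partition.decreasing la) π rpp
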